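{- Let $q\ge 2$ be a prime power and $r_1,r_2\ge 1$. Let $G_1$ and $G_2$ be regular subgroups of $GA(r_1,q)$ and $GA(r_2,q)$, and let $\tau_1,\tau_2$ be the permutations of $F_q^{r_1}$ and $F_q^{r_2}$ induced by automorphisms $T_1$ of $G_1$ and $T_2$ of $G_2$, respectively. Then $\tau_1|\tau_2$ is the permutation of $F_q^{r_1+r_2}$ induced by an automorphism of the regular subgroup $G_1\otimes G_2$ of $GA(r_1+r_2,q)$, and the code $S_{\tau_1|\tau_2}$ is propelinear.
   Context: The general affine group $GA(r,q)$ consists of pairs $(a,M)$, $a\in F_q^r$, $M\in GL(r,q)$, acting on column vectors by $(a,M)(b)=a+Mb$, with composition $(a,M)(b,M')=(a+Mb,MM')$. A subgroup $G\le GA(r,q)$ is regular if it acts regularly on $F_q^r$; then for each $a$ there is a unique $g_a\in G$ with $g_a({\bf 0})=a$, and the permutation $\tau$ of $F_q^r$ induced by an automorphism $T$ of $G$ is defined by $g_{\tau(a)}=T(g_a)$. For $(a,M_1)\in G_1$, $(b,M_2)\in G_2$ let $(a,M_1)\otimes(b,M_2)=\left(\binom{a}{b},\begin{pmatrix}M_1&0\\0&M_2\end{pmatrix}\right)\in GA(r_1+r_2,q)$ and $G_1\otimes G_2=\{g_1\otimes g_2: g_1\in G_1,g_2\in G_2\}$. For permutations $\tau_1$ of $F_q^{r_1}$ and $\tau_2$ of $F_q^{r_2}$, $\tau_1|\tau_2$ is the permutation of $F_q^{r_1+r_2}$ given by $(\tau_1|\tau_2)\binom{a}{b}=\binom{\tau_1(a)}{\tau_2(b)}$.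 For $r\ge1$ and a permutation $\tau$ of $F_q^r$, with $n=\frac{q^r-1}{q-1}$: let $H_C$ be an $r\times n$ matrix whose columns represent the $n$ one-dimensional subspaces of $F_q^r$, $C_a=\{x\in F_q^n:H_Cx^T=a\}$; let $D=\{y=(y_c)_{c\in F_q^r}:\sum_c y_c=0,\ \sum_c y_c c={\bf 0}\}$ (length $q^r$, positions indexed by $F_q^r$), $e_c$ the unit vector at position $c$, $D_a=D+e_{\bf 0}-e_a$; then $S_\tau=\bigcup_{a\in F_q^r}C_a\times D_{\tau(a)}=\{(x|y): a\in F_q^r, x\in C_a, y\in D_{\tau(a)}\}$ (concatenation), a code of length $\frac{q^{r+1}-1}{q-1}$. A code $S\subseteq F_q^N$ is propelinear if the group of isometries of $F_q^N$ (Hamming metric) stabilizing $S$ contains a subgroup acting regularly on $S$. -}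

module Defs where

open import Level using (0ℓ)
open import Data.Nat using (ℕ; zero; suc; _+_)
open import Data.Fin using (Fin)
open import Data.Product using (Σ; ∃; ∃-syntax; _×_; _,_)
open import Data.List as List using (List)
open import Data.List.Membership.Propositional using (_∈_)
open import Data.List.Relation.Unary.Unique.Propositional using (Unique)
open import Data.Vec as Vec using (Vec; []; _∷_; _++_)
open import Relation.Nullary using (¬_; Dec; does)
open import Relation.Binary.PropositionalEquality using (_≡_; _≢_; _≗_)
open import Relation.Binary.Definitions using (DecidableEquality)
open import Data.Bool using (if_then_else_)
import Data.Vec.Properties as VecP
open import Algebra.Structures using (IsCommutativeRing)
open import Function using (_∘_; id)

-- A finite field F_q (equality is propositional equality).
-- q = number of elements; a finite field automatically has prime-power
-- order q ≥ 2, so "q a prime power, q ≥ 2" is encoded by "F is a finite field".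

record FiniteField : Set₁ where
  infixl 6 _+ᶠ_
  infixl 7 _*ᶠ_
  field
    Carrier : Set
    _+ᶠ_ _*ᶠ_ : Carrier → Carrier → Carrier
    -ᶠ_     : Carrier → Carrier
    0# 1#   : Carrier
    isCommutativeRing : IsCommutativeRing _≡_ _+ᶠ_ _*ᶠ_ -ᶠ_ 0# 1#
    0≢1     : 0# ≢ 1#
    inverse : ∀ x → x ≢ 0# → ∃[ y ] (x *ᶠ y ≡ 1#)
    _≟_     : DecidableEquality Carrier
    elements : List Carrier
    complete : ∀ x → x ∈ elements
    unique   : Unique elements

module Over (F : FiniteField) where
  open FiniteField F public using (Carrier; 0#; 1#)
  open FiniteField F using (_+ᶠ_; _*ᶠ_; -ᶠ_; _≟_; elements)

  V : ℕ → Set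
  V r = Vec Carrier r

  𝟎 : ∀ {r} → V r
  𝟎 = Vec.replicate _ 0#

  _⊕_ : ∀ {r} → V r → V r → V r
  _⊕_ = Vec.zipWith _+ᶠ_

  ⊖_ : ∀ {r} → V r → V r
  ⊖_ = Vec.map -ᶠ_

  _•_ : ∀ {r} → Carrier → V r → V r
  c • v = Vec.map (c *ᶠ_) v

  dot : ∀ {r} → V r → V r → Carrier
  dot u v = Vec.foldr _ _+ᶠ_ 0# (Vec.zipWith _*ᶠ_ u v)

  Mat : ℕ → ℕ → Set
  Mat m n = Vec (Vec Carrier n) m

  _·ᵥ_ : ∀ {m n} → Mat m n → V n → V m
  M ·ᵥ b = Vec.map (λ row → dot row b) M

  _·ₘ_ : ∀ {m n k} → Mat m n → Mat n k → Mat m k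
  M ·ₘ N = Vec.map (λ row → Vec.map (λ col → dot row col) (Vec.transpose N)) M

  Iₘ : ∀ {r} → Mat r r
  Iₘ = Vec.tabulate (λ i → Vec.tabulate (λ j →
         if does (i Data.Fin.≟ j) then 1# else 0#))

  Invertible : ∀ {r} → Mat r r → Set
  Invertible M = ∃[ N ] ((M ·ₘ N ≡ Iₘ) × (N ·ₘ M ≡ Iₘ))

  Aff : ℕ → Set
  Aff r = V r × Mat r r

  InGA : ∀ {r} → Aff r → Set
  InGA (_ , M) = Invertible M

  act : ∀ {r} → Aff r → V r → V r
  act (a , M) b = a ⊕ (M ·ᵥ b)

  _∘ₐ_ : ∀ {r} → Aff r → Aff r → Aff r
  (a , M) ∘ₐ (b , M') = (a ⊕ (M ·ᵥ b) , M ·ₘ M')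

  idₐ : ∀ {r} → Aff r
  idₐ = (𝟎 , Iₘ)

  record IsSubgroupGA {r} (G : Aff r → Set) : Set where
    field
      inGA   : ∀ g → G g → InGA g
      hasId  : G idₐ
      closed : ∀ g h → G g → G h → G (g ∘ₐ h)
      inv    : ∀ g → G g → ∃[ h ] (G h × (g ∘ₐ h ≡ idₐ) × (h ∘ₐ g ≡ idₐ))

  IsRegularAction : ∀ {r} → (Aff r → Set) → Set
  IsRegularAction {r} G =
    (∀ (a : V r) → ∃[ g ] (G g × act g 𝟎 ≡ a)) ×
    (∀ g h → G g → G h → act g 𝟎 ≡ act h 𝟎 → g ≡ h)

  IsRegularSubgroup : ∀ {r} → (Aff r → Set) → Set
  IsRegularSubgroup G = IsSubgroupGA G × IsRegularAction G

  record IsAutomorphism {r} (G : Aff r → Set) (T : Aff r → Aff r) : Set where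
    field
      maps     : ∀ g → G g → G (T g)
      hom      : ∀ g h → G g → G h → T (g ∘ₐ h) ≡ T g ∘ₐ T h
      injective  : ∀ g h → G g → G h → T g ≡ T h → g ≡ h
      surjective : ∀ h → G h → ∃[ g ] (G g × T g ≡ h)

  -- τ is the permutation induced by T: g_{τ(a)} = T(g_a), i.e. for every
  -- g ∈ G with g(0) = a, T(g)(0) = τ(a).
  Induces : ∀ {r} → (Aff r → Set) → (Aff r → Aff r) → (V r → V r) → Set
  Induces G T τ = ∀ g → G g → τ (act g 𝟎) ≡ act (T g) 𝟎

  blockDiag : ∀ {r₁ r₂} → Mat r₁ r₁ → Mat r₂ r₂ → Mat (r₁ + r₂) (r₁ + r₂)
  blockDiag M₁ M₂ = Vec.map (λ row → row ++ 𝟎) M₁ ++ Vec.map (λ row → 𝟎 ++ row) M₂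

  _⊗ₐ_ : ∀ {r₁ r₂} → Aff r₁ → Aff r₂ → Aff (r₁ + r₂)
  (a , M₁) ⊗ₐ (b , M₂) = (a ++ b , blockDiag M₁ M₂)

  _⊗_ : ∀ {r₁ r₂} → (Aff r₁ → Set) → (Aff r₂ → Set) → Aff (r₁ + r₂) → Set
  (G₁ ⊗ G₂) g = ∃[ g₁ ] ∃[ g₂ ] (G₁ g₁ × G₂ g₂ × g ≡ g₁ ⊗ₐ g₂)

  _∣ₚ_ : ∀ {r₁ r₂} → (V r₁ → V r₁) → (V r₂ → V r₂) → V (r₁ + r₂) → V (r₁ + r₂)
  _∣ₚ_ {r₁} τ₁ τ₂ v = τ₁ (Vec.take r₁ v) ++ τ₂ (Vec.drop r₁ v)

  allVecs : ∀ r → List (V r)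
  allVecs zero    = List.[ [] ]
  allVecs (suc r) = List.concatMap (λ x → List.map (x ∷_) (allVecs r)) elements

  -- Q = q^r, the positions of the D-part are indexed by F_q^r via allVecs
  Q : ℕ → ℕ
  Q r = List.length (allVecs r)

  pos : ∀ {r} → Fin (Q r) → V r
  pos {r} i = Vec.lookup (Vec.fromList (allVecs r)) i

  -- H_C : r × n matrix, given by its n columns, whose columns represent the
  -- n one-dimensional subspaces of F_q^r (each exactly once).
  record IsSubspaceMatrix {r n} (cols : Vec (V r) n) : Set where
    field
      nonzero : ∀ j → Vec.lookup cols j ≢ 𝟎
      covers  : ∀ (v : V r) → v ≢ 𝟎 → ∃[ j ] ∃[ λ' ] (v ≡ λ' • Vec.lookup cols j)
      distinct : ∀ (v : V r) j j' λ' λ'' → v ≢ 𝟎 →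
                 v ≡ λ' • Vec.lookup cols j → v ≡ λ'' • Vec.lookup cols j' → j ≡ j'

  syndrome : ∀ {r n} → Vec (V r) n → Vec Carrier n → V r
  syndrome cols x = Vec.foldr _ _⊕_ 𝟎 (Vec.zipWith _•_ x cols)

  C : ∀ {r n} → Vec (V r) n → V r → Vec Carrier n → Set
  C cols a x = syndrome cols x ≡ a

  D : ∀ r → Vec Carrier (Q r) → Set
  D r y = (Vec.foldr _ _+ᶠ_ 0# y ≡ 0#) ×
          (Vec.foldr _ _⊕_ 𝟎 (Vec.tabulate (λ i → Vec.lookup y i • pos {r} i)) ≡ 𝟎)

  e : ∀ {r} → V r → Vec Carrier (Q r)
  e {r} c = Vec.tabulate (λ i → if does (VecP.≡-dec _≟_ (pos i) c) then 1# else 0#)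

  Dₐ : ∀ r → V r → Vec Carrier (Q r) → Set
  Dₐ r a y = ∃[ d ] (D r d × y ≡ (d ⊕ e {r} 𝟎) ⊕ (⊖ e {r} a))

  S : ∀ {r n} → Vec (V r) n → (V r → V r) → Vec Carrier (n + Q r) → Set
  S {r} cols τ w = ∃[ a ] ∃[ x ] ∃[ y ] (C cols a x × Dₐ r (τ a) y × w ≡ x ++ y)

  dist : ∀ {N} → Vec Carrier N → Vec Carrier N → ℕ
  dist [] [] = 0
  dist (x ∷ xs) (y ∷ ys) = (if does (x ≟ y) then 0 else 1) Data.Nat.+ dist xs ys

  IsIsometry : ∀ {N} → (Vec Carrier N → Vec Carrier N) → Set
  IsIsometry {N} φ = (∀ x y → dist (φ x) (φ y) ≡ dist x y) ×
                     ∃[ ψ ] ((φ ∘ ψ ≗ id) × (ψ ∘ φ ≗ id))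

  Stabilizes : ∀ {N} → (Vec Carrier N → Set) → (Vec Carrier N → Vec Carrier N) → Set
  Stabilizes Sc φ = ∀ x → (Sc x → Sc (φ x)) × (Sc (φ x) → Sc x)

  record IsRegularStabSubgroup {N} (Sc : Vec Carrier N → Set)
           (Π : (Vec Carrier N → Vec Carrier N) → Set) : Set₁ where
    field
      isometry : ∀ φ → Π φ → IsIsometry φ
      stab     : ∀ φ → Π φ → Stabilizes Sc φ
      hasId    : Π id
      closed   : ∀ φ ψ → Π φ → Π ψ → Π (φ ∘ ψ)
      inv      : ∀ φ → Π φ → ∃[ ψ ] (Π ψ × (φ ∘ ψ ≗ id) × (ψ ∘ φ ≗ id))
      transitive : ∀ x y → Sc x → Sc y → ∃[ φ ] (Π φ × φ x ≡ y)
      free     : ∀ φ ψ x → Π φ → Π ψ → Sc x → φ x ≡ ψ x → φ ≗ ψ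

  Propelinear : ∀ {N} → (Vec Carrier N → Set) → Set₁
  Propelinear {N} Sc = ∃[ Π ] IsRegularStabSubgroup Sc Π

{-# OPTIONS --safe #-}
module Submission where

-- A regular subgroup G ≤ GA(r,q) makes F_q^r a group under a ⋆ b = g_a(b), and a permutation τ
-- induced by an automorphism of G is an automorphism of (F_q^r, ⋆).  The linear part M_a of g_a
-- permutes the one-dimensional subspaces, so it moves the columns of H_C to nonzero multiples of
-- columns; this gives a monomial map μ_a of F_q^n with H_C μ_a(x) = M_a H_C x.  Likewise M_a
-- relabels the coordinates of the D-part and maps D_u onto D_{M_a u}.  For a codeword
-- s = (x | y) ∈ C_a × D_{τ(a)} the map
--   φ_s (x′ | y′) = (x + μ_a(x′) | y + ψ_a(y′)),   ψ_a = relabelling by M_{τ(a)},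
-- is a monomial map followed by a translation, hence a Hamming isometry; it maps S_τ to itself
-- because τ(a ⋆ b) = τ(a) ⋆ τ(b), and φ_s ∘ φ_t = φ_{φ_s(t)} (a semidirect-product law), so the
-- φ_s, s ∈ S_τ, form a group acting regularly on S_τ.  For G₁ ⊗ G₂ everything is componentwise:
-- it is regular, T₁ ⊗ T₂ (acting on the two diagonal blocks) is an automorphism, and it induces τ₁|τ₂.

open import Defs
open import Data.Nat using (ℕ; _≥_)
open import Data.Product using (Σ; ∃-syntax; _×_)
open import Data.Vec using (Vec)

open import Level using (0ℓ)
open import Data.Nat using (zero; suc; _+_)
import Data.Nat.Properties as ℕ
open import Data.Fin as Fin using (Fin; zero; suc; _↑ˡ_; _↑ʳ_)
open import Data.Fin.Properties using (suc-injective; ↑ˡ-injective; ↑ʳ-injective)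
open import Data.Fin.Permutation using (permutation)
open import Data.Product using (proj₁; proj₂; _,_)
open import Data.Empty using (⊥-elim)
open import Data.Bool using (if_then_else_)
open import Data.List as List using (List)
open import Data.List.Membership.Propositional using (_∈_)
open import Data.List.Membership.Propositional.Properties using (∈-lookup; ∈-cartesianProductWith⁺)
import Data.List.Relation.Unary.All as All
import Data.List.Relation.Unary.AllPairs as AllPairs
import Data.List.Relation.Unary.Any as Any
open import Data.List.Relation.Unary.Any.Properties using (lookup-index)
open import Data.List.Relation.Unary.Unique.Propositional using (Unique)
import Data.List.Relation.Unary.Unique.Propositional.Properties as Unique
open import Data.Vec using ([]; _∷_; _++_; lookup; tabulate; take; drop; replicate; transpose; _⊛_; foldr; zipWith)
import Data.Vec as Vec
open import Data.Vec.Properties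
  using (≡-dec; tabulate∘lookup; tabulate-cong; lookup∘tabulate; lookup-map; lookup-zipWith; lookup-replicate;
         lookup-++ˡ; lookup-++ʳ; lookup-⊛; map-++; map-∘; map-cong; map-id; zipWith-++;
         zipWith-assoc; zipWith-identityˡ; zipWith-identityʳ; zipWith-inverseˡ; zipWith-inverseʳ; zipWith-comm;
         ++-injectiveˡ; ++-injectiveʳ; take++drop≡id; ∷-injective)
open import Relation.Nullary using (yes; no; does)
open import Relation.Binary.PropositionalEquality
open import Function using (_∘_; id)
open import Algebra.Bundles using (CommutativeRing; AbelianGroup; Group)
open import Algebra.Structures using (IsAbelianGroup; IsGroup)
import Algebra.Properties.Ring as RingProperties
import Algebra.Properties.AbelianGroup as AbelianGroupProperties
import Algebra.Properties.Group as GroupProperties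
import Algebra.Properties.Semiring.Sum as SemiringSum
import Algebra.Properties.CommutativeMonoid.Sum as CommutativeMonoidSum

lookup-ext : ∀ {a} {A : Set a} {n} {u v : Vec A n} → (∀ i → lookup u i ≡ lookup v i) → u ≡ v
lookup-ext {u = u} {v} h = begin
  u                    ≡⟨ tabulate∘lookup u ⟨
  tabulate (lookup u)  ≡⟨ tabulate-cong h ⟩
  tabulate (lookup v)  ≡⟨ tabulate∘lookup v ⟩
  v                    ∎
  where open ≡-Reasoning

take-++ : ∀ {a} {A : Set a} {m n} (xs : Vec A m) (ys : Vec A n) → take m (xs ++ ys) ≡ xs
take-++ []       ys = refl
take-++ (x ∷ xs) ys = cong (x ∷_) (take-++ xs ys)

drop-++ : ∀ {a} {A : Set a} {m n} (xs : Vec A m) (ys : Vec A n) → drop m (xs ++ ys) ≡ ys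
drop-++ []       ys = refl
drop-++ (x ∷ xs) ys = drop-++ xs ys

↑-elim : ∀ m {n p} {P : Fin (m + n) → Set p} → (∀ i → P (i ↑ˡ n)) → (∀ j → P (m ↑ʳ j)) → ∀ k → P k
↑-elim zero    left right k       = right k
↑-elim (suc m) left right zero    = left zero
↑-elim (suc m) {P = P} left right (suc k) = ↑-elim m {P = P ∘ suc} (left ∘ suc) right k

↑ˡ≢↑ʳ : ∀ {m n} (i : Fin m) (j : Fin n) → i ↑ˡ n ≢ m ↑ʳ j
↑ˡ≢↑ʳ zero    j ()
↑ˡ≢↑ʳ (suc i) j eq = ↑ˡ≢↑ʳ i j (suc-injective eq)

concatMap-map≡cartesianProductWith : ∀ {a b c} {A : Set a} {B : Set b} {C : Set c} (f : A → B → C) xs ys →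
  List.concatMap (λ x → List.map (f x) ys) xs ≡ List.cartesianProductWith f xs ys
concatMap-map≡cartesianProductWith f List.[]       ys = refl
concatMap-map≡cartesianProductWith f (x List.∷ xs) ys =
  cong (List.map (f x) ys List.++_) (concatMap-map≡cartesianProductWith f xs ys)

lookup-fromList : ∀ {a} {A : Set a} (xs : List A) i → lookup (Vec.fromList xs) i ≡ List.lookup xs i
lookup-fromList (x List.∷ xs) zero    = refl
lookup-fromList (x List.∷ xs) (suc i) = lookup-fromList xs i

lookup-injective : ∀ {a} {A : Set a} {xs : List A} → Unique xs → ∀ i j → List.lookup xs i ≡ List.lookup xs j → i ≡ j
lookup-injective (x∉xs AllPairs.∷ _) zero    zero    _  = refl
lookup-injective (x∉xs AllPairs.∷ _) zero    (suc j) eq = ⊥-elim (All.lookup x∉xs (∈-lookup j) eq)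
lookup-injective (x∉xs AllPairs.∷ _) (suc i) zero    eq = ⊥-elim (All.lookup x∉xs (∈-lookup i) (sym eq))
lookup-injective (_ AllPairs.∷ uxs)  (suc i) (suc j) eq = cong suc (lookup-injective uxs i j eq)

module Scalars (F : FiniteField) where
  open FiniteField F using (Carrier; _+ᶠ_; _*ᶠ_; -ᶠ_; 0#; 1#; isCommutativeRing; inverse)

  commutativeRing : CommutativeRing 0ℓ 0ℓ
  commutativeRing = record { isCommutativeRing = isCommutativeRing }

  open CommutativeRing commutativeRing public
    using (+-assoc; +-comm; +-identityˡ; +-identityʳ; -‿inverseˡ; -‿inverseʳ;
           *-assoc; *-comm; *-identityˡ; distribˡ; distribʳ; zeroˡ; zeroʳ)
  open RingProperties (CommutativeRing.ring commutativeRing) public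
    using (-0#≈0#; +-cancelˡ; -1*x≈-x; x∙y⁻¹≈ε⇒x≈y; [y-z]x≈yx-zx)

  *-cancelˡ-nonZero : ∀ c a b → c ≢ 0# → c *ᶠ a ≡ c *ᶠ b → a ≡ b
  *-cancelˡ-nonZero c a b c≢0 ca≡cb with inverse c c≢0
  ... | c⁻¹ , cc⁻¹≡1 = begin
    a                ≡⟨ *-identityˡ a ⟨
    1# *ᶠ a          ≡⟨ cong (_*ᶠ a) c⁻¹c≡1 ⟨
    (c⁻¹ *ᶠ c) *ᶠ a  ≡⟨ *-assoc c⁻¹ c a ⟩
    c⁻¹ *ᶠ (c *ᶠ a)  ≡⟨ cong (c⁻¹ *ᶠ_) ca≡cb ⟩
    c⁻¹ *ᶠ (c *ᶠ b)  ≡⟨ *-assoc c⁻¹ c b ⟨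
    (c⁻¹ *ᶠ c) *ᶠ b  ≡⟨ cong (_*ᶠ b) c⁻¹c≡1 ⟩
    1# *ᶠ b          ≡⟨ *-identityˡ b ⟩
    b                ∎
    where
    open ≡-Reasoning
    c⁻¹c≡1 : c⁻¹ *ᶠ c ≡ 1#
    c⁻¹c≡1 = trans (*-comm c⁻¹ c) cc⁻¹≡1

  *-swapˡ : ∀ a b c → a *ᶠ (b *ᶠ c) ≡ b *ᶠ (a *ᶠ c)
  *-swapˡ a b c = trans (sym (*-assoc a b c)) (trans (cong (_*ᶠ c) (*-comm a b)) (*-assoc b a c))

  private module Sum = SemiringSum (CommutativeRing.semiring commutativeRing)

  -- Sums are opaque so that Agda can infer the summands in ∑-cong and friends.
  opaque
    ∑ : ∀ {n} → (Fin n → Carrier) → Carrier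
    ∑ = Sum.sum

    ∑-empty : (f : Fin 0 → Carrier) → ∑ f ≡ 0#
    ∑-empty f = refl

    ∑-suc : ∀ {n} (f : Fin (suc n) → Carrier) → ∑ f ≡ f zero +ᶠ ∑ (f ∘ suc)
    ∑-suc f = refl

    ∑-cong : ∀ {n} {f g : Fin n → Carrier} → (∀ i → f i ≡ g i) → ∑ f ≡ ∑ g
    ∑-cong = Sum.sum-cong-≗

    ∑-+ : ∀ {n} (f g : Fin n → Carrier) → ∑ (λ i → f i +ᶠ g i) ≡ ∑ f +ᶠ ∑ g
    ∑-+ = Sum.∑-distrib-+

    ∑-comm : ∀ {m n} (f : Fin m → Fin n → Carrier) → ∑ (λ i → ∑ (f i)) ≡ ∑ (λ j → ∑ (λ i → f i j))
    ∑-comm = Sum.∑-comm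

    *-distribˡ-∑ : ∀ {n} c (f : Fin n → Carrier) → c *ᶠ ∑ f ≡ ∑ (λ i → c *ᶠ f i)
    *-distribˡ-∑ = Sum.*-distribˡ-sum

    *-distribʳ-∑ : ∀ {n} c (f : Fin n → Carrier) → ∑ f *ᶠ c ≡ ∑ (λ i → f i *ᶠ c)
    *-distribʳ-∑ = Sum.*-distribʳ-sum

    ∑-zero : ∀ {n} (f : Fin n → Carrier) → (∀ i → f i ≡ 0#) → ∑ f ≡ 0#
    ∑-zero {n} f f≡0 = trans (Sum.sum-cong-≗ f≡0) (Sum.sum-replicate-zero n)

    ∑-reindex : ∀ {n} (f : Fin n → Carrier) (p q : Fin n → Fin n) →
                (∀ i → p (q i) ≡ i) → (∀ i → q (p i) ≡ i) → ∑ f ≡ ∑ (f ∘ p)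
    ∑-reindex f p q pq qp = Sum.sum-permute f (permutation p q pq qp)

  ∑-neg : ∀ {n} (f : Fin n → Carrier) → ∑ (λ i → -ᶠ f i) ≡ -ᶠ ∑ f
  ∑-neg f = begin
    ∑ (λ i → -ᶠ f i)          ≡⟨ ∑-cong (λ i → -1*x≈-x (f i)) ⟨
    ∑ (λ i → (-ᶠ 1#) *ᶠ f i)  ≡⟨ *-distribˡ-∑ (-ᶠ 1#) f ⟨
    (-ᶠ 1#) *ᶠ ∑ f            ≡⟨ -1*x≈-x (∑ f) ⟩
    -ᶠ ∑ f                    ∎
    where open ≡-Reasoning

  ∑-supported-at : ∀ {n} (f : Fin n → Carrier) i₀ → (∀ i → i ≢ i₀ → f i ≡ 0#) → ∑ f ≡ f i₀
  ∑-supported-at {suc n} f zero    f≡0 = begin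
    ∑ f                    ≡⟨ ∑-suc f ⟩
    f zero +ᶠ ∑ (f ∘ suc)  ≡⟨ cong (f zero +ᶠ_) (∑-zero (f ∘ suc) (λ i → f≡0 (suc i) λ ())) ⟩
    f zero +ᶠ 0#           ≡⟨ +-identityʳ _ ⟩
    f zero                 ∎
    where open ≡-Reasoning
  ∑-supported-at {suc n} f (suc j) f≡0 = begin
    ∑ f                    ≡⟨ ∑-suc f ⟩
    f zero +ᶠ ∑ (f ∘ suc)
      ≡⟨ cong₂ _+ᶠ_ (f≡0 zero λ ()) (∑-supported-at (f ∘ suc) j (λ i i≢j → f≡0 (suc i) (i≢j ∘ suc-injective))) ⟩
    0# +ᶠ f (suc j)        ≡⟨ +-identityˡ _ ⟩
    f (suc j)              ∎
    where open ≡-Reasoning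

module Vectors (F : FiniteField) where
  open FiniteField F using (_+ᶠ_; _*ᶠ_; -ᶠ_; _≟_)
  open Over F
  open Scalars F

  lookup-⊕ : ∀ {r} (u v : V r) i → lookup (u ⊕ v) i ≡ lookup u i +ᶠ lookup v i
  lookup-⊕ u v i = lookup-zipWith _ i u v

  lookup-𝟎 : ∀ {r} i → lookup (𝟎 {r}) i ≡ 0#
  lookup-𝟎 i = lookup-replicate i 0#

  lookup-⊖ : ∀ {r} (v : V r) i → lookup (⊖ v) i ≡ -ᶠ lookup v i
  lookup-⊖ v i = lookup-map i _ v

  lookup-• : ∀ {r} c (v : V r) i → lookup (c • v) i ≡ c *ᶠ lookup v i
  lookup-• c v i = lookup-map i _ v

  ⊕-isAbelianGroup : ∀ {r} → IsAbelianGroup _≡_ (_⊕_ {r}) 𝟎 ⊖_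
  ⊕-isAbelianGroup = record
    { isGroup = record
      { isMonoid = record
        { isSemigroup = record
          { isMagma = record { isEquivalence = isEquivalence ; ∙-cong = cong₂ _⊕_ }
          ; assoc = zipWith-assoc +-assoc }
        ; identity = zipWith-identityˡ +-identityˡ , zipWith-identityʳ +-identityʳ }
      ; inverse = zipWith-inverseˡ -‿inverseˡ , zipWith-inverseʳ -‿inverseʳ
      ; ⁻¹-cong = cong ⊖_ }
    ; comm = zipWith-comm +-comm }

  ⊕-abelianGroup : ℕ → AbelianGroup 0ℓ 0ℓ
  ⊕-abelianGroup r = record { isAbelianGroup = ⊕-isAbelianGroup {r} }

  module _ {r : ℕ} where
    open IsAbelianGroup (⊕-isAbelianGroup {r}) public
      using () renaming (assoc to ⊕-assoc; identityˡ to ⊕-identityˡ; identityʳ to ⊕-identityʳ;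
                         inverseˡ to ⊕-inverseˡ; inverseʳ to ⊕-inverseʳ)
    open AbelianGroupProperties (⊕-abelianGroup r) public
      using () renaming (∙-cancelʳ to ⊕-cancelʳ; inverseʳ-unique to ⊕-inverseʳ-unique; identityʳ-unique to ⊕-identityʳ-unique;
                         ⁻¹-involutive to ⊖-involutive; ε⁻¹≈ε to ⊖-𝟎; ⁻¹-∙-comm to ⊖-⊕)

  module _ {m n} (f : V m → V n) (f-⊕ : ∀ u v → f (u ⊕ v) ≡ f u ⊕ f v) where
    additive-𝟎 : f 𝟎 ≡ 𝟎
    additive-𝟎 = ⊕-identityʳ-unique (f 𝟎) (f 𝟎) (trans (sym (f-⊕ 𝟎 𝟎)) (cong f (⊕-identityˡ 𝟎)))

    additive-⊖ : ∀ v → f (⊖ v) ≡ ⊖ f v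
    additive-⊖ v = ⊕-inverseʳ-unique (f v) (f (⊖ v)) (trans (sym (f-⊕ v (⊖ v))) (trans (cong f (⊕-inverseʳ v)) additive-𝟎))

  permute : ∀ {n} → (Fin n → Fin n) → V n → V n
  permute π x = tabulate (lookup x ∘ π)

  rescale : ∀ {n} → (Fin n → Carrier) → V n → V n
  rescale c x = tabulate (λ k → c k *ᶠ lookup x k)

  permute-⊕ : ∀ {n} (π : Fin n → Fin n) x y → permute π (x ⊕ y) ≡ permute π x ⊕ permute π y
  permute-⊕ π x y = lookup-ext λ k → trans (lookup∘tabulate _ k) (trans (lookup-⊕ x y (π k))
    (sym (trans (lookup-⊕ (permute π x) (permute π y) k) (cong₂ _+ᶠ_ (lookup∘tabulate _ k) (lookup∘tabulate _ k)))))

  rescale-⊕ : ∀ {n} (c : Fin n → Carrier) x y → rescale c (x ⊕ y) ≡ rescale c x ⊕ rescale c y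
  rescale-⊕ c x y = lookup-ext λ k → trans (lookup∘tabulate _ k) (trans (cong (c k *ᶠ_) (lookup-⊕ x y k)) (trans (distribˡ _ _ _)
    (sym (trans (lookup-⊕ (rescale c x) (rescale c y) k) (cong₂ _+ᶠ_ (lookup∘tabulate _ k) (lookup∘tabulate _ k))))))

  •-assoc : ∀ {r} c d (v : V r) → c • (d • v) ≡ (c *ᶠ d) • v
  •-assoc c d v = lookup-ext λ i → begin
    lookup (c • (d • v)) i    ≡⟨ lookup-• c (d • v) i ⟩
    c *ᶠ lookup (d • v) i     ≡⟨ cong (c *ᶠ_) (lookup-• d v i) ⟩
    c *ᶠ (d *ᶠ lookup v i)    ≡⟨ *-assoc c d _ ⟨
    (c *ᶠ d) *ᶠ lookup v i    ≡⟨ lookup-• (c *ᶠ d) v i ⟨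
    lookup ((c *ᶠ d) • v) i   ∎
    where open ≡-Reasoning

  •-zeroˡ : ∀ {r} (v : V r) → 0# • v ≡ 𝟎
  •-zeroˡ v = lookup-ext λ i → trans (lookup-• 0# v i) (trans (zeroˡ _) (sym (lookup-𝟎 i)))

  •-identityˡ : ∀ {r} (v : V r) → 1# • v ≡ v
  •-identityˡ v = lookup-ext λ i → trans (lookup-• 1# v i) (*-identityˡ _)

  •-cancelʳ-nonZero : ∀ {r} (w : V r) c c′ → w ≢ 𝟎 → c • w ≡ c′ • w → c ≡ c′
  •-cancelʳ-nonZero w c c′ w≢𝟎 cw≡c′w with (c +ᶠ (-ᶠ c′)) ≟ 0#
  ... | yes c-c′≡0 = x∙y⁻¹≈ε⇒x≈y c c′ c-c′≡0
  ... | no  c-c′≢0 = ⊥-elim (w≢𝟎 (lookup-ext λ k → *-cancelˡ-nonZero _ _ _ c-c′≢0 (begin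
      (c +ᶠ (-ᶠ c′)) *ᶠ lookup w k
        ≡⟨ [y-z]x≈yx-zx _ c c′ ⟩
      c *ᶠ lookup w k +ᶠ (-ᶠ (c′ *ᶠ lookup w k))
        ≡⟨ cong₂ (λ x y → x +ᶠ (-ᶠ y)) (lookup-• c w k) (lookup-• c′ w k) ⟨
      lookup (c • w) k +ᶠ (-ᶠ lookup (c′ • w) k)
        ≡⟨ cong (λ u → lookup (c • w) k +ᶠ (-ᶠ lookup u k)) cw≡c′w ⟨
      lookup (c • w) k +ᶠ (-ᶠ lookup (c • w) k)
        ≡⟨ -‿inverseʳ _ ⟩
      0#
        ≡⟨ zeroʳ _ ⟨
      (c +ᶠ (-ᶠ c′)) *ᶠ 0#
        ≡⟨ cong (_ *ᶠ_) (lookup-𝟎 k) ⟨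
      (c +ᶠ (-ᶠ c′)) *ᶠ lookup 𝟎 k ∎)))
    where open ≡-Reasoning

  lookup-foldr-⊕ : ∀ {m r} (ws : Vec (V r) m) k → lookup (foldr _ _⊕_ 𝟎 ws) k ≡ ∑ (λ j → lookup (lookup ws j) k)
  lookup-foldr-⊕ []       k = trans (lookup-𝟎 k) (sym (∑-empty _))
  lookup-foldr-⊕ (w ∷ ws) k =
    trans (lookup-⊕ w _ k) (trans (cong (lookup w k +ᶠ_) (lookup-foldr-⊕ ws k)) (sym (∑-suc _)))

  foldr-+≡∑ : ∀ {m} (v : Vec Carrier m) → foldr _ _+ᶠ_ 0# v ≡ ∑ (lookup v)
  foldr-+≡∑ []      = sym (∑-empty _)
  foldr-+≡∑ (x ∷ v) = trans (cong (x +ᶠ_) (foldr-+≡∑ v)) (sym (∑-suc _))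

  dot≡∑ : ∀ {r} (u v : V r) → dot u v ≡ ∑ (λ i → lookup u i *ᶠ lookup v i)
  dot≡∑ u v = trans (foldr-+≡∑ (zipWith _*ᶠ_ u v)) (∑-cong (λ i → lookup-zipWith _ i u v))

  𝟎-++ : ∀ m n → 𝟎 {m + n} ≡ 𝟎 {m} ++ 𝟎 {n}
  𝟎-++ zero    n = refl
  𝟎-++ (suc m) n = cong (0# ∷_) (𝟎-++ m n)

  ⊕-++ : ∀ {m n} (a c : V m) (b d : V n) → (a ++ b) ⊕ (c ++ d) ≡ (a ⊕ c) ++ (b ⊕ d)
  ⊕-++ a c b d = zipWith-++ _+ᶠ_ a b c d

  dot-++ : ∀ {m n} (u v : V m) (u′ v′ : V n) → dot (u ++ u′) (v ++ v′) ≡ dot u v +ᶠ dot u′ v′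
  dot-++ []      []      u′ v′ = sym (+-identityˡ _)
  dot-++ (x ∷ u) (y ∷ v) u′ v′ = trans (cong (x *ᶠ y +ᶠ_) (dot-++ u v u′ v′)) (sym (+-assoc _ _ _))

  dot-𝟎ˡ : ∀ {m} (v : V m) → dot 𝟎 v ≡ 0#
  dot-𝟎ˡ []      = refl
  dot-𝟎ˡ (y ∷ v) = trans (cong₂ _+ᶠ_ (zeroˡ y) (dot-𝟎ˡ v)) (+-identityˡ 0#)

module Matrices (F : FiniteField) where
  open FiniteField F using (_+ᶠ_; _*ᶠ_)
  open Over F
  open Scalars F
  open Vectors F

  entry : ∀ {m n} → Mat m n → Fin m → Fin n → Carrier
  entry M i j = lookup (lookup M i) j

  column : ∀ {m n} → Mat m n → Fin n → V m
  column M k = lookup (transpose M) k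

  lookup-transpose-∷ : ∀ {a} {A : Set a} {m n} (as : Vec A n) (ass : Vec (Vec A n) m) k →
                       lookup (transpose (as ∷ ass)) k ≡ lookup as k ∷ lookup (transpose ass) k
  lookup-transpose-∷ {n = n} as ass k =
    trans (lookup-⊛ k (replicate n _∷_ ⊛ as) (transpose ass))
          (cong (λ f → f (lookup (transpose ass) k))
                (trans (lookup-⊛ k (replicate n _∷_) as) (cong (λ f → f (lookup as k)) (lookup-replicate k _∷_))))

  lookup-column : ∀ {m n} (M : Mat m n) k i → lookup (column M k) i ≡ entry M i k
  lookup-column (as ∷ ass) k zero    = cong (λ v → lookup v zero) (lookup-transpose-∷ as ass k)
  lookup-column (as ∷ ass) k (suc i) =
    trans (cong (λ v → lookup v (suc i)) (lookup-transpose-∷ as ass k)) (lookup-column ass k i)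

  column-ext : ∀ {m n} {M N : Mat m n} → (∀ k → column M k ≡ column N k) → M ≡ N
  column-ext {M = M} {N} h = lookup-ext λ i → lookup-ext λ k →
    trans (sym (lookup-column M k i)) (trans (cong (λ v → lookup v i) (h k)) (lookup-column N k i))

  lookup-·ᵥ : ∀ {m n} (M : Mat m n) (b : V n) i → lookup (M ·ᵥ b) i ≡ dot (lookup M i) b
  lookup-·ᵥ M b i = lookup-map i _ M

  column-·ₘ : ∀ {m n p} (M : Mat m n) (N : Mat n p) k → column (M ·ₘ N) k ≡ M ·ᵥ column N k
  column-·ₘ M N k = lookup-ext λ i → begin
    lookup (column (M ·ₘ N) k) i          ≡⟨ lookup-column (M ·ₘ N) k i ⟩
    lookup (lookup (M ·ₘ N) i) k          ≡⟨ cong (λ row → lookup row k) (lookup-map i _ M) ⟩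
    lookup (Vec.map (dot (lookup M i)) (transpose N)) k ≡⟨ lookup-map k _ (transpose N) ⟩
    dot (lookup M i) (column N k)         ≡⟨ lookup-·ᵥ M (column N k) i ⟨
    lookup (M ·ᵥ column N k) i            ∎
    where open ≡-Reasoning

  lookup-·ᵥ-∑ : ∀ {m n} (M : Mat m n) (b : V n) i → lookup (M ·ᵥ b) i ≡ ∑ (λ j → entry M i j *ᶠ lookup b j)
  lookup-·ᵥ-∑ M b i = trans (lookup-·ᵥ M b i) (dot≡∑ (lookup M i) b)

  entry-·ₘ : ∀ {m n p} (M : Mat m n) (N : Mat n p) i k → entry (M ·ₘ N) i k ≡ ∑ (λ j → entry M i j *ᶠ entry N j k)
  entry-·ₘ M N i k = begin
    entry (M ·ₘ N) i k                              ≡⟨ lookup-column (M ·ₘ N) k i ⟨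
    lookup (column (M ·ₘ N) k) i                    ≡⟨ cong (λ c → lookup c i) (column-·ₘ M N k) ⟩
    lookup (M ·ᵥ column N k) i                      ≡⟨ lookup-·ᵥ-∑ M (column N k) i ⟩
    ∑ (λ j → entry M i j *ᶠ lookup (column N k) j) ≡⟨ ∑-cong (λ j → cong (entry M i j *ᶠ_) (lookup-column N k j)) ⟩
    ∑ (λ j → entry M i j *ᶠ entry N j k)          ∎
    where open ≡-Reasoning

  ·ₘ-·ᵥ-assoc : ∀ {m n p} (M : Mat m n) (N : Mat n p) (v : V p) → (M ·ₘ N) ·ᵥ v ≡ M ·ᵥ (N ·ᵥ v)
  ·ₘ-·ᵥ-assoc M N v = lookup-ext λ i → begin
    lookup ((M ·ₘ N) ·ᵥ v) i
      ≡⟨ lookup-·ᵥ-∑ (M ·ₘ N) v i ⟩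
    ∑ (λ k → entry (M ·ₘ N) i k *ᶠ lookup v k)
      ≡⟨ ∑-cong (λ k → cong (_*ᶠ lookup v k) (entry-·ₘ M N i k)) ⟩
    ∑ (λ k → ∑ (λ j → entry M i j *ᶠ entry N j k) *ᶠ lookup v k)
      ≡⟨ ∑-cong (λ k → *-distribʳ-∑ (lookup v k) (λ j → entry M i j *ᶠ entry N j k)) ⟩
    ∑ (λ k → ∑ (λ j → (entry M i j *ᶠ entry N j k) *ᶠ lookup v k))
      ≡⟨ ∑-comm _ ⟩
    ∑ (λ j → ∑ (λ k → (entry M i j *ᶠ entry N j k) *ᶠ lookup v k))
      ≡⟨ ∑-cong (λ j → ∑-cong (λ k → *-assoc _ _ _)) ⟩
    ∑ (λ j → ∑ (λ k → entry M i j *ᶠ (entry N j k *ᶠ lookup v k)))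
      ≡⟨ ∑-cong (λ j → *-distribˡ-∑ (entry M i j) (λ k → entry N j k *ᶠ lookup v k)) ⟨
    ∑ (λ j → entry M i j *ᶠ ∑ (λ k → entry N j k *ᶠ lookup v k))
      ≡⟨ ∑-cong (λ j → cong (entry M i j *ᶠ_) (lookup-·ᵥ-∑ N v j)) ⟨
    ∑ (λ j → entry M i j *ᶠ lookup (N ·ᵥ v) j)
      ≡⟨ lookup-·ᵥ-∑ M (N ·ᵥ v) i ⟨
    lookup (M ·ᵥ (N ·ᵥ v)) i ∎
    where open ≡-Reasoning

  ·ᵥ-⊕ : ∀ {m n} (M : Mat m n) (u v : V n) → M ·ᵥ (u ⊕ v) ≡ (M ·ᵥ u) ⊕ (M ·ᵥ v)
  ·ᵥ-⊕ M u v = lookup-ext λ i → begin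
    lookup (M ·ᵥ (u ⊕ v)) i                                 ≡⟨ lookup-·ᵥ-∑ M (u ⊕ v) i ⟩
    ∑ (λ j → entry M i j *ᶠ lookup (u ⊕ v) j)
      ≡⟨ ∑-cong (λ j → trans (cong (entry M i j *ᶠ_) (lookup-⊕ u v j)) (distribˡ _ _ _)) ⟩
    ∑ (λ j → entry M i j *ᶠ lookup u j +ᶠ entry M i j *ᶠ lookup v j) ≡⟨ ∑-+ _ _ ⟩
    ∑ (λ j → entry M i j *ᶠ lookup u j) +ᶠ ∑ (λ j → entry M i j *ᶠ lookup v j)
      ≡⟨ cong₂ _+ᶠ_ (lookup-·ᵥ-∑ M u i) (lookup-·ᵥ-∑ M v i) ⟨
    lookup (M ·ᵥ u) i +ᶠ lookup (M ·ᵥ v) i                  ≡⟨ lookup-⊕ (M ·ᵥ u) (M ·ᵥ v) i ⟨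
    lookup ((M ·ᵥ u) ⊕ (M ·ᵥ v)) i                          ∎
    where open ≡-Reasoning

  ·ᵥ-• : ∀ {m n} (M : Mat m n) c (v : V n) → M ·ᵥ (c • v) ≡ c • (M ·ᵥ v)
  ·ᵥ-• M c v = lookup-ext λ i → begin
    lookup (M ·ᵥ (c • v)) i
      ≡⟨ lookup-·ᵥ-∑ M (c • v) i ⟩
    ∑ (λ j → entry M i j *ᶠ lookup (c • v) j)
      ≡⟨ ∑-cong (λ j → trans (cong (entry M i j *ᶠ_) (lookup-• c v j)) (*-swapˡ _ c _)) ⟩
    ∑ (λ j → c *ᶠ (entry M i j *ᶠ lookup v j))
      ≡⟨ *-distribˡ-∑ c (λ j → entry M i j *ᶠ lookup v j) ⟨
    c *ᶠ ∑ (λ j → entry M i j *ᶠ lookup v j)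
      ≡⟨ cong (c *ᶠ_) (lookup-·ᵥ-∑ M v i) ⟨
    c *ᶠ lookup (M ·ᵥ v) i
      ≡⟨ lookup-• c (M ·ᵥ v) i ⟨
    lookup (c • (M ·ᵥ v)) i ∎
    where open ≡-Reasoning

  ·ᵥ-𝟎 : ∀ {m n} (M : Mat m n) → M ·ᵥ 𝟎 ≡ 𝟎
  ·ᵥ-𝟎 M = additive-𝟎 (M ·ᵥ_) (·ᵥ-⊕ M)

  ·ᵥ-⊖ : ∀ {m n} (M : Mat m n) (v : V n) → M ·ᵥ (⊖ v) ≡ ⊖ (M ·ᵥ v)
  ·ᵥ-⊖ M = additive-⊖ (M ·ᵥ_) (·ᵥ-⊕ M)

  ·ᵥ-linear-combination : ∀ {m n k} (N : Mat m n) (c : Fin k → Carrier) (v : Fin k → V n) (w : V n) →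
                          (∀ l → lookup w l ≡ ∑ (λ j → c j *ᶠ lookup (v j) l)) →
                          ∀ i → lookup (N ·ᵥ w) i ≡ ∑ (λ j → c j *ᶠ lookup (N ·ᵥ v j) i)
  ·ᵥ-linear-combination N c v w w≡∑ i = begin
    lookup (N ·ᵥ w) i
      ≡⟨ lookup-·ᵥ-∑ N w i ⟩
    ∑ (λ l → entry N i l *ᶠ lookup w l)
      ≡⟨ ∑-cong (λ l → cong (entry N i l *ᶠ_) (w≡∑ l)) ⟩
    ∑ (λ l → entry N i l *ᶠ ∑ (λ j → c j *ᶠ lookup (v j) l))
      ≡⟨ ∑-cong (λ l → *-distribˡ-∑ (entry N i l) (λ j → c j *ᶠ lookup (v j) l)) ⟩
    ∑ (λ l → ∑ (λ j → entry N i l *ᶠ (c j *ᶠ lookup (v j) l)))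
      ≡⟨ ∑-comm _ ⟩
    ∑ (λ j → ∑ (λ l → entry N i l *ᶠ (c j *ᶠ lookup (v j) l)))
      ≡⟨ ∑-cong (λ j → ∑-cong (λ l → *-swapˡ _ _ _)) ⟩
    ∑ (λ j → ∑ (λ l → c j *ᶠ (entry N i l *ᶠ lookup (v j) l)))
      ≡⟨ ∑-cong (λ j → *-distribˡ-∑ (c j) (λ l → entry N i l *ᶠ lookup (v j) l)) ⟨
    ∑ (λ j → c j *ᶠ ∑ (λ l → entry N i l *ᶠ lookup (v j) l))
      ≡⟨ ∑-cong (λ j → cong (c j *ᶠ_) (lookup-·ᵥ-∑ N (v j) i)) ⟨
    ∑ (λ j → c j *ᶠ lookup (N ·ᵥ v j) i) ∎
    where open ≡-Reasoning

  entry-Iₘ : ∀ {r} (i j : Fin r) → entry (Iₘ {r}) i j ≡ (if does (i Fin.≟ j) then 1# else 0#)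
  entry-Iₘ i j = trans (cong (λ row → lookup row j) (lookup∘tabulate _ i)) (lookup∘tabulate _ j)

  entry-Iₘ-diagonal : ∀ {r} (i : Fin r) → entry (Iₘ {r}) i i ≡ 1#
  entry-Iₘ-diagonal i with i Fin.≟ i | entry-Iₘ i i
  ... | yes _  | eq = eq
  ... | no i≢i | _  = ⊥-elim (i≢i refl)

  entry-Iₘ-off-diagonal : ∀ {r} (i j : Fin r) → i ≢ j → entry (Iₘ {r}) i j ≡ 0#
  entry-Iₘ-off-diagonal i j i≢j with i Fin.≟ j | entry-Iₘ i j
  ... | yes i≡j | _  = ⊥-elim (i≢j i≡j)
  ... | no _    | eq = eq

  Iₘ-·ᵥ : ∀ {r} (v : V r) → Iₘ ·ᵥ v ≡ v
  Iₘ-·ᵥ v = lookup-ext λ i → begin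
    lookup (Iₘ ·ᵥ v) i
      ≡⟨ lookup-·ᵥ-∑ Iₘ v i ⟩
    ∑ (λ j → entry Iₘ i j *ᶠ lookup v j)
      ≡⟨ ∑-supported-at _ i (λ j j≢i → trans (cong (_*ᶠ lookup v j) (entry-Iₘ-off-diagonal i j (j≢i ∘ sym))) (zeroˡ _)) ⟩
    entry Iₘ i i *ᶠ lookup v i
      ≡⟨ cong (_*ᶠ lookup v i) (entry-Iₘ-diagonal i) ⟩
    1# *ᶠ lookup v i
      ≡⟨ *-identityˡ _ ⟩
    lookup v i ∎
    where open ≡-Reasoning

  entry-Iₘ-injective : ∀ {m n} (f : Fin m → Fin n) → (∀ {i j} → f i ≡ f j → i ≡ j) →
                       ∀ i j → entry Iₘ (f i) (f j) ≡ entry Iₘ i j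
  entry-Iₘ-injective f f-injective i j with i Fin.≟ j
  ... | yes refl = trans (entry-Iₘ-diagonal (f i)) (sym (entry-Iₘ-diagonal i))
  ... | no  i≢j  = trans (entry-Iₘ-off-diagonal (f i) (f j) (i≢j ∘ f-injective)) (sym (entry-Iₘ-off-diagonal i j i≢j))

  module _ {r₁ r₂ : ℕ} (M₁ : Mat r₁ r₁) (M₂ : Mat r₂ r₂) where
    lookup-blockDiag-↑ˡ : ∀ i → lookup (blockDiag M₁ M₂) (i ↑ˡ r₂) ≡ lookup M₁ i ++ 𝟎
    lookup-blockDiag-↑ˡ i = trans (lookup-++ˡ (Vec.map (_++ 𝟎) M₁) _ i) (lookup-map i _ M₁)

    lookup-blockDiag-↑ʳ : ∀ i → lookup (blockDiag M₁ M₂) (r₁ ↑ʳ i) ≡ 𝟎 ++ lookup M₂ i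
    lookup-blockDiag-↑ʳ i = trans (lookup-++ʳ (Vec.map (_++ 𝟎) M₁) _ i) (lookup-map i _ M₂)

    entry-blockDiag-↑ˡ↑ˡ : ∀ i j → entry (blockDiag M₁ M₂) (i ↑ˡ r₂) (j ↑ˡ r₂) ≡ entry M₁ i j
    entry-blockDiag-↑ˡ↑ˡ i j =
      trans (cong (λ row → lookup row (j ↑ˡ r₂)) (lookup-blockDiag-↑ˡ i)) (lookup-++ˡ (lookup M₁ i) 𝟎 j)

    entry-blockDiag-↑ˡ↑ʳ : ∀ i j → entry (blockDiag M₁ M₂) (i ↑ˡ r₂) (r₁ ↑ʳ j) ≡ 0#
    entry-blockDiag-↑ˡ↑ʳ i j =
      trans (cong (λ row → lookup row (r₁ ↑ʳ j)) (lookup-blockDiag-↑ˡ i))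
            (trans (lookup-++ʳ (lookup M₁ i) (𝟎 {r₂}) j) (lookup-𝟎 j))

    entry-blockDiag-↑ʳ↑ˡ : ∀ i j → entry (blockDiag M₁ M₂) (r₁ ↑ʳ i) (j ↑ˡ r₂) ≡ 0#
    entry-blockDiag-↑ʳ↑ˡ i j =
      trans (cong (λ row → lookup row (j ↑ˡ r₂)) (lookup-blockDiag-↑ʳ i))
            (trans (lookup-++ˡ (𝟎 {r₁}) (lookup M₂ i) j) (lookup-𝟎 j))

    entry-blockDiag-↑ʳ↑ʳ : ∀ i j → entry (blockDiag M₁ M₂) (r₁ ↑ʳ i) (r₁ ↑ʳ j) ≡ entry M₂ i j
    entry-blockDiag-↑ʳ↑ʳ i j =
      trans (cong (λ row → lookup row (r₁ ↑ʳ j)) (lookup-blockDiag-↑ʳ i)) (lookup-++ʳ (𝟎 {r₁}) (lookup M₂ i) j)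

    blockDiag-·ᵥ : ∀ a b → blockDiag M₁ M₂ ·ᵥ (a ++ b) ≡ (M₁ ·ᵥ a) ++ (M₂ ·ᵥ b)
    blockDiag-·ᵥ a b = trans (map-++ _ (Vec.map (_++ 𝟎) M₁) (Vec.map (𝟎 ++_) M₂))
      (cong₂ _++_ (trans (sym (map-∘ _ _ M₁)) (map-cong upper M₁)) (trans (sym (map-∘ _ _ M₂)) (map-cong lower M₂)))
      where
      upper : ∀ row → dot (row ++ 𝟎) (a ++ b) ≡ dot row a
      upper row = trans (dot-++ row a 𝟎 b) (trans (cong (dot row a +ᶠ_) (dot-𝟎ˡ b)) (+-identityʳ _))
      lower : ∀ row → dot (𝟎 ++ row) (a ++ b) ≡ dot row b
      lower row = trans (dot-++ 𝟎 a row b) (trans (cong (_+ᶠ dot row b) (dot-𝟎ˡ a)) (+-identityˡ _))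

    column-blockDiag-↑ˡ : ∀ k → column (blockDiag M₁ M₂) (k ↑ˡ r₂) ≡ column M₁ k ++ 𝟎
    column-blockDiag-↑ˡ k = lookup-ext (↑-elim r₁
      (λ i → trans (lookup-column (blockDiag M₁ M₂) _ (i ↑ˡ r₂)) (trans (entry-blockDiag-↑ˡ↑ˡ i k)
               (sym (trans (lookup-++ˡ (column M₁ k) (𝟎 {r₂}) i) (lookup-column M₁ k i)))))
      (λ i → trans (lookup-column (blockDiag M₁ M₂) _ (r₁ ↑ʳ i)) (trans (entry-blockDiag-↑ʳ↑ˡ i k)
               (sym (trans (lookup-++ʳ (column M₁ k) (𝟎 {r₂}) i) (lookup-𝟎 i))))))

    column-blockDiag-↑ʳ : ∀ k → column (blockDiag M₁ M₂) (r₁ ↑ʳ k) ≡ 𝟎 ++ column M₂ k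
    column-blockDiag-↑ʳ k = lookup-ext (↑-elim r₁
      (λ i → trans (lookup-column (blockDiag M₁ M₂) _ (i ↑ˡ r₂)) (trans (entry-blockDiag-↑ˡ↑ʳ i k)
               (sym (trans (lookup-++ˡ (𝟎 {r₁}) (column M₂ k) i) (lookup-𝟎 i)))))
      (λ i → trans (lookup-column (blockDiag M₁ M₂) _ (r₁ ↑ʳ i)) (trans (entry-blockDiag-↑ʳ↑ʳ i k)
               (sym (trans (lookup-++ʳ (𝟎 {r₁}) (column M₂ k) i) (lookup-column M₂ k i))))))

  blockDiag-·ₘ : ∀ {r₁ r₂} (M₁ N₁ : Mat r₁ r₁) (M₂ N₂ : Mat r₂ r₂) →
                 blockDiag M₁ M₂ ·ₘ blockDiag N₁ N₂ ≡ blockDiag (M₁ ·ₘ N₁) (M₂ ·ₘ N₂)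
  blockDiag-·ₘ {r₁} {r₂} M₁ N₁ M₂ N₂ = column-ext (↑-elim r₁ left right)
    where
    open ≡-Reasoning
    left : ∀ k → column (blockDiag M₁ M₂ ·ₘ blockDiag N₁ N₂) (k ↑ˡ r₂) ≡
                 column (blockDiag (M₁ ·ₘ N₁) (M₂ ·ₘ N₂)) (k ↑ˡ r₂)
    left k = begin
      column (blockDiag M₁ M₂ ·ₘ blockDiag N₁ N₂) (k ↑ˡ r₂)
        ≡⟨ column-·ₘ (blockDiag M₁ M₂) (blockDiag N₁ N₂) _ ⟩
      blockDiag M₁ M₂ ·ᵥ column (blockDiag N₁ N₂) (k ↑ˡ r₂)
        ≡⟨ cong (blockDiag M₁ M₂ ·ᵥ_) (column-blockDiag-↑ˡ N₁ N₂ k) ⟩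
      blockDiag M₁ M₂ ·ᵥ (column N₁ k ++ 𝟎)
        ≡⟨ blockDiag-·ᵥ M₁ M₂ _ 𝟎 ⟩
      (M₁ ·ᵥ column N₁ k) ++ (M₂ ·ᵥ 𝟎)
        ≡⟨ cong₂ _++_ (sym (column-·ₘ M₁ N₁ k)) (·ᵥ-𝟎 M₂) ⟩
      column (M₁ ·ₘ N₁) k ++ 𝟎
        ≡⟨ column-blockDiag-↑ˡ (M₁ ·ₘ N₁) (M₂ ·ₘ N₂) k ⟨
      column (blockDiag (M₁ ·ₘ N₁) (M₂ ·ₘ N₂)) (k ↑ˡ r₂) ∎
    right : ∀ k → column (blockDiag M₁ M₂ ·ₘ blockDiag N₁ N₂) (r₁ ↑ʳ k) ≡
                  column (blockDiag (M₁ ·ₘ N₁) (M₂ ·ₘ N₂)) (r₁ ↑ʳ k)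
    right k = begin
      column (blockDiag M₁ M₂ ·ₘ blockDiag N₁ N₂) (r₁ ↑ʳ k)
        ≡⟨ column-·ₘ (blockDiag M₁ M₂) (blockDiag N₁ N₂) _ ⟩
      blockDiag M₁ M₂ ·ᵥ column (blockDiag N₁ N₂) (r₁ ↑ʳ k)
        ≡⟨ cong (blockDiag M₁ M₂ ·ᵥ_) (column-blockDiag-↑ʳ N₁ N₂ k) ⟩
      blockDiag M₁ M₂ ·ᵥ (𝟎 ++ column N₂ k)
        ≡⟨ blockDiag-·ᵥ M₁ M₂ 𝟎 _ ⟩
      (M₁ ·ᵥ 𝟎) ++ (M₂ ·ᵥ column N₂ k)
        ≡⟨ cong₂ _++_ (·ᵥ-𝟎 M₁) (sym (column-·ₘ M₂ N₂ k)) ⟩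
      𝟎 ++ column (M₂ ·ₘ N₂) k
        ≡⟨ column-blockDiag-↑ʳ (M₁ ·ₘ N₁) (M₂ ·ₘ N₂) k ⟨
      column (blockDiag (M₁ ·ₘ N₁) (M₂ ·ₘ N₂)) (r₁ ↑ʳ k) ∎

  blockDiag-Iₘ : ∀ {r₁ r₂} → blockDiag (Iₘ {r₁}) (Iₘ {r₂}) ≡ Iₘ
  blockDiag-Iₘ {r₁} {r₂} = lookup-ext (↑-elim r₁
    (λ i → lookup-ext (↑-elim r₁
      (λ j → trans (entry-blockDiag-↑ˡ↑ˡ (Iₘ {r₁}) (Iₘ {r₂}) i j) (sym (entry-Iₘ-injective (_↑ˡ r₂) (↑ˡ-injective r₂ _ _) i j)))
      (λ j → trans (entry-blockDiag-↑ˡ↑ʳ (Iₘ {r₁}) (Iₘ {r₂}) i j) (sym (entry-Iₘ-off-diagonal _ _ (↑ˡ≢↑ʳ i j))))))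
    (λ i → lookup-ext (↑-elim r₁
      (λ j → trans (entry-blockDiag-↑ʳ↑ˡ (Iₘ {r₁}) (Iₘ {r₂}) i j) (sym (entry-Iₘ-off-diagonal _ _ (↑ˡ≢↑ʳ j i ∘ sym))))
      (λ j → trans (entry-blockDiag-↑ʳ↑ʳ (Iₘ {r₁}) (Iₘ {r₂}) i j) (sym (entry-Iₘ-injective (r₁ ↑ʳ_) (↑ʳ-injective r₁ _ _) i j))))))

module Affine (F : FiniteField) where
  open Over F
  open Vectors F
  open Matrices F

  act-∘ₐ : ∀ {r} (g h : Aff r) v → act (g ∘ₐ h) v ≡ act g (act h v)
  act-∘ₐ (a , M) (b , N) v = begin
    (a ⊕ (M ·ᵥ b)) ⊕ ((M ·ₘ N) ·ᵥ v)  ≡⟨ cong ((a ⊕ (M ·ᵥ b)) ⊕_) (·ₘ-·ᵥ-assoc M N v) ⟩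
    (a ⊕ (M ·ᵥ b)) ⊕ (M ·ᵥ (N ·ᵥ v))  ≡⟨ ⊕-assoc a _ _ ⟩
    a ⊕ ((M ·ᵥ b) ⊕ (M ·ᵥ (N ·ᵥ v)))  ≡⟨ cong (a ⊕_) (·ᵥ-⊕ M b (N ·ᵥ v)) ⟨
    a ⊕ (M ·ᵥ (b ⊕ (N ·ᵥ v)))         ∎
    where open ≡-Reasoning

  act-idₐ : ∀ {r} (v : V r) → act idₐ v ≡ v
  act-idₐ v = trans (⊕-identityˡ _) (Iₘ-·ᵥ v)

  module _ {r₁ r₂ : ℕ} where
    ⊗ₐ-∘ₐ : ∀ (g₁ h₁ : Aff r₁) (g₂ h₂ : Aff r₂) →
            (g₁ ⊗ₐ g₂) ∘ₐ (h₁ ⊗ₐ h₂) ≡ (g₁ ∘ₐ h₁) ⊗ₐ (g₂ ∘ₐ h₂)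
    ⊗ₐ-∘ₐ (a , M₁) (a′ , N₁) (b , M₂) (b′ , N₂) =
      cong₂ _,_ (trans (cong ((a ++ b) ⊕_) (blockDiag-·ᵥ M₁ M₂ a′ b′)) (⊕-++ a _ b _)) (blockDiag-·ₘ M₁ N₁ M₂ N₂)

    idₐ-⊗ₐ : idₐ {r₁} ⊗ₐ idₐ {r₂} ≡ idₐ
    idₐ-⊗ₐ = cong₂ _,_ (sym (𝟎-++ r₁ r₂)) (blockDiag-Iₘ {r₁} {r₂})

    act-⊗ₐ : ∀ (g₁ : Aff r₁) (g₂ : Aff r₂) u v → act (g₁ ⊗ₐ g₂) (u ++ v) ≡ act g₁ u ++ act g₂ v
    act-⊗ₐ (a , M₁) (b , M₂) u v = trans (cong ((a ++ b) ⊕_) (blockDiag-·ᵥ M₁ M₂ u v)) (⊕-++ a _ b _)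

    act-⊗ₐ-𝟎 : ∀ (g₁ : Aff r₁) (g₂ : Aff r₂) → act (g₁ ⊗ₐ g₂) 𝟎 ≡ act g₁ 𝟎 ++ act g₂ 𝟎
    act-⊗ₐ-𝟎 g₁ g₂ = trans (cong (act (g₁ ⊗ₐ g₂)) (𝟎-++ r₁ r₂)) (act-⊗ₐ g₁ g₂ 𝟎 𝟎)

    InGA-⊗ₐ : ∀ (g₁ : Aff r₁) (g₂ : Aff r₂) → InGA g₁ → InGA g₂ → InGA (g₁ ⊗ₐ g₂)
    InGA-⊗ₐ (_ , M₁) (_ , M₂) (N₁ , M₁N₁≡I , N₁M₁≡I) (N₂ , M₂N₂≡I , N₂M₂≡I) =
      blockDiag N₁ N₂ ,
      trans (blockDiag-·ₘ M₁ N₁ M₂ N₂) (trans (cong₂ blockDiag M₁N₁≡I M₂N₂≡I) (blockDiag-Iₘ {r₁} {r₂})) ,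
      trans (blockDiag-·ₘ N₁ M₁ N₂ M₂) (trans (cong₂ blockDiag N₁M₁≡I N₂M₂≡I) (blockDiag-Iₘ {r₁} {r₂}))

    leftFactor : Aff (r₁ + r₂) → Aff r₁
    leftFactor (v , M) = take r₁ v , Vec.map (take r₁) (take r₁ M)

    rightFactor : Aff (r₁ + r₂) → Aff r₂
    rightFactor (v , M) = drop r₁ v , Vec.map (drop r₁) (drop r₁ M)

    leftFactor-⊗ₐ : ∀ g₁ g₂ → leftFactor (g₁ ⊗ₐ g₂) ≡ g₁
    leftFactor-⊗ₐ (a , M₁) (b , M₂) = cong₂ _,_ (take-++ a b) (begin
      Vec.map (take r₁) (take r₁ (Vec.map (_++ 𝟎) M₁ ++ Vec.map (𝟎 ++_) M₂))
        ≡⟨ cong (Vec.map (take r₁)) (take-++ (Vec.map (_++ 𝟎) M₁) _) ⟩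
      Vec.map (take r₁) (Vec.map (_++ 𝟎) M₁)  ≡⟨ map-∘ _ _ M₁ ⟨
      Vec.map (λ row → take r₁ (row ++ 𝟎)) M₁ ≡⟨ map-cong (λ row → take-++ row (𝟎 {r₂})) M₁ ⟩
      Vec.map id M₁                           ≡⟨ map-id M₁ ⟩
      M₁                                      ∎)
      where open ≡-Reasoning

    rightFactor-⊗ₐ : ∀ g₁ g₂ → rightFactor (g₁ ⊗ₐ g₂) ≡ g₂
    rightFactor-⊗ₐ (a , M₁) (b , M₂) = cong₂ _,_ (drop-++ a b) (begin
      Vec.map (drop r₁) (drop r₁ (Vec.map (_++ 𝟎) M₁ ++ Vec.map (𝟎 ++_) M₂))
        ≡⟨ cong (Vec.map (drop r₁)) (drop-++ (Vec.map (_++ 𝟎) M₁) _) ⟩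
      Vec.map (drop r₁) (Vec.map (𝟎 ++_) M₂)  ≡⟨ map-∘ _ _ M₂ ⟨
      Vec.map (λ row → drop r₁ (𝟎 ++ row)) M₂ ≡⟨ map-cong (λ row → drop-++ (𝟎 {r₁}) row) M₂ ⟩
      Vec.map id M₂                           ≡⟨ map-id M₂ ⟩
      M₂                                      ∎)
      where open ≡-Reasoning

    ⊗ₐ-injective : ∀ {g₁ h₁ g₂ h₂} → g₁ ⊗ₐ g₂ ≡ h₁ ⊗ₐ h₂ → g₁ ≡ h₁ × g₂ ≡ h₂
    ⊗ₐ-injective {g₁} {h₁} {g₂} {h₂} eq =
      trans (sym (leftFactor-⊗ₐ g₁ g₂)) (trans (cong leftFactor eq) (leftFactor-⊗ₐ h₁ h₂)) ,
      trans (sym (rightFactor-⊗ₐ g₁ g₂)) (trans (cong rightFactor eq) (rightFactor-⊗ₐ h₁ h₂))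

module Tensor (F : FiniteField) {r₁ r₂ : ℕ} where
  open Over F
  open Affine F

  ⊗-isSubgroupGA : ∀ {G₁ G₂} → IsSubgroupGA {r₁} G₁ → IsSubgroupGA {r₂} G₂ → IsSubgroupGA (G₁ ⊗ G₂)
  ⊗-isSubgroupGA {G₁} {G₂} H₁ H₂ = record
    { inGA   = λ { _ (g₁ , g₂ , p₁ , p₂ , refl) → InGA-⊗ₐ g₁ g₂ (H₁.inGA g₁ p₁) (H₂.inGA g₂ p₂) }
    ; hasId  = idₐ , idₐ , H₁.hasId , H₂.hasId , sym (idₐ-⊗ₐ {r₁} {r₂})
    ; closed = λ { _ _ (g₁ , g₂ , p₁ , p₂ , refl) (h₁ , h₂ , q₁ , q₂ , refl) →
                   g₁ ∘ₐ h₁ , g₂ ∘ₐ h₂ , H₁.closed _ _ p₁ q₁ , H₂.closed _ _ p₂ q₂ , ⊗ₐ-∘ₐ g₁ h₁ g₂ h₂ }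
    ; inv    = λ { _ (g₁ , g₂ , p₁ , p₂ , refl) → ⊗-inverse (H₁.inv g₁ p₁) (H₂.inv g₂ p₂) }
    }
    where
    module H₁ = IsSubgroupGA H₁
    module H₂ = IsSubgroupGA H₂
    ⊗-inverse : ∀ {g₁ g₂} → ∃[ h ] (G₁ h × (g₁ ∘ₐ h ≡ idₐ) × (h ∘ₐ g₁ ≡ idₐ)) →
                ∃[ h ] (G₂ h × (g₂ ∘ₐ h ≡ idₐ) × (h ∘ₐ g₂ ≡ idₐ)) →
                ∃[ h ] ((G₁ ⊗ G₂) h × ((g₁ ⊗ₐ g₂) ∘ₐ h ≡ idₐ) × (h ∘ₐ (g₁ ⊗ₐ g₂) ≡ idₐ))
    ⊗-inverse {g₁} {g₂} (h₁ , q₁ , gh₁ , hg₁) (h₂ , q₂ , gh₂ , hg₂) =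
      h₁ ⊗ₐ h₂ , (h₁ , h₂ , q₁ , q₂ , refl) ,
      trans (⊗ₐ-∘ₐ g₁ h₁ g₂ h₂) (trans (cong₂ _⊗ₐ_ gh₁ gh₂) (idₐ-⊗ₐ {r₁} {r₂})) ,
      trans (⊗ₐ-∘ₐ h₁ g₁ h₂ g₂) (trans (cong₂ _⊗ₐ_ hg₁ hg₂) (idₐ-⊗ₐ {r₁} {r₂}))

  ⊗-isRegularAction : ∀ {G₁ G₂} → IsRegularAction {r₁} G₁ → IsRegularAction {r₂} G₂ → IsRegularAction (G₁ ⊗ G₂)
  ⊗-isRegularAction {G₁} {G₂} (transitive₁ , free₁) (transitive₂ , free₂) = transitive , free
    where
    transitive : ∀ a → ∃[ g ] ((G₁ ⊗ G₂) g × act g 𝟎 ≡ a)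
    transitive a with transitive₁ (take r₁ a) | transitive₂ (drop r₁ a)
    ... | g₁ , p₁ , g₁𝟎≡a₁ | g₂ , p₂ , g₂𝟎≡a₂ =
      g₁ ⊗ₐ g₂ , (g₁ , g₂ , p₁ , p₂ , refl) ,
      trans (act-⊗ₐ-𝟎 g₁ g₂) (trans (cong₂ _++_ g₁𝟎≡a₁ g₂𝟎≡a₂) (take++drop≡id r₁ a))
    free : ∀ g h → (G₁ ⊗ G₂) g → (G₁ ⊗ G₂) h → act g 𝟎 ≡ act h 𝟎 → g ≡ h
    free _ _ (g₁ , g₂ , p₁ , p₂ , refl) (h₁ , h₂ , q₁ , q₂ , refl) eq =
      cong₂ _⊗ₐ_ (free₁ g₁ h₁ p₁ q₁ (++-injectiveˡ _ _ eq′)) (free₂ g₂ h₂ p₂ q₂ (++-injectiveʳ _ _ eq′))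
      where
      eq′ : act g₁ 𝟎 ++ act g₂ 𝟎 ≡ act h₁ 𝟎 ++ act h₂ 𝟎
      eq′ = trans (sym (act-⊗ₐ-𝟎 g₁ g₂)) (trans eq (act-⊗ₐ-𝟎 h₁ h₂))

  ⊗-isRegularSubgroup : ∀ {G₁ G₂} → IsRegularSubgroup {r₁} G₁ → IsRegularSubgroup {r₂} G₂ → IsRegularSubgroup (G₁ ⊗ G₂)
  ⊗-isRegularSubgroup (H₁ , R₁) (H₂ , R₂) = ⊗-isSubgroupGA H₁ H₂ , ⊗-isRegularAction R₁ R₂

  _⊗ᵀ_ : (Aff r₁ → Aff r₁) → (Aff r₂ → Aff r₂) → Aff (r₁ + r₂) → Aff (r₁ + r₂)
  (T₁ ⊗ᵀ T₂) g = T₁ (leftFactor g) ⊗ₐ T₂ (rightFactor g)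

  ⊗ᵀ-⊗ₐ : ∀ T₁ T₂ g₁ g₂ → (T₁ ⊗ᵀ T₂) (g₁ ⊗ₐ g₂) ≡ T₁ g₁ ⊗ₐ T₂ g₂
  ⊗ᵀ-⊗ₐ T₁ T₂ g₁ g₂ = cong₂ (λ x y → T₁ x ⊗ₐ T₂ y) (leftFactor-⊗ₐ g₁ g₂) (rightFactor-⊗ₐ g₁ g₂)

  ⊗-isAutomorphism : ∀ {G₁ G₂ T₁ T₂} → IsAutomorphism {r₁} G₁ T₁ → IsAutomorphism {r₂} G₂ T₂ →
                     IsAutomorphism (G₁ ⊗ G₂) (T₁ ⊗ᵀ T₂)
  ⊗-isAutomorphism {G₁} {G₂} {T₁} {T₂} A₁ A₂ = record
    { maps       = λ { _ (g₁ , g₂ , p₁ , p₂ , refl) →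
                     T₁ g₁ , T₂ g₂ , A₁.maps g₁ p₁ , A₂.maps g₂ p₂ , ⊗ᵀ-⊗ₐ T₁ T₂ g₁ g₂ }
    ; hom        = λ { _ _ (g₁ , g₂ , p₁ , p₂ , refl) (h₁ , h₂ , q₁ , q₂ , refl) → hom g₁ g₂ h₁ h₂ p₁ p₂ q₁ q₂ }
    ; injective  = λ { _ _ (g₁ , g₂ , p₁ , p₂ , refl) (h₁ , h₂ , q₁ , q₂ , refl) eq →
                     let eq₁ , eq₂ = ⊗ₐ-injective (trans (sym (⊗ᵀ-⊗ₐ T₁ T₂ g₁ g₂)) (trans eq (⊗ᵀ-⊗ₐ T₁ T₂ h₁ h₂)))
                     in cong₂ _⊗ₐ_ (A₁.injective _ _ p₁ q₁ eq₁) (A₂.injective _ _ p₂ q₂ eq₂) }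
    ; surjective = λ { _ (h₁ , h₂ , q₁ , q₂ , refl) → surjective (A₁.surjective h₁ q₁) (A₂.surjective h₂ q₂) }
    }
    where
    module A₁ = IsAutomorphism A₁
    module A₂ = IsAutomorphism A₂
    T : Aff (r₁ + r₂) → Aff (r₁ + r₂)
    T = T₁ ⊗ᵀ T₂
    hom : ∀ g₁ g₂ h₁ h₂ → G₁ g₁ → G₂ g₂ → G₁ h₁ → G₂ h₂ →
          T ((g₁ ⊗ₐ g₂) ∘ₐ (h₁ ⊗ₐ h₂)) ≡ T (g₁ ⊗ₐ g₂) ∘ₐ T (h₁ ⊗ₐ h₂)
    hom g₁ g₂ h₁ h₂ p₁ p₂ q₁ q₂ = begin
      T ((g₁ ⊗ₐ g₂) ∘ₐ (h₁ ⊗ₐ h₂))             ≡⟨ cong T (⊗ₐ-∘ₐ g₁ h₁ g₂ h₂) ⟩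
      T ((g₁ ∘ₐ h₁) ⊗ₐ (g₂ ∘ₐ h₂))             ≡⟨ ⊗ᵀ-⊗ₐ T₁ T₂ _ _ ⟩
      T₁ (g₁ ∘ₐ h₁) ⊗ₐ T₂ (g₂ ∘ₐ h₂)           ≡⟨ cong₂ _⊗ₐ_ (A₁.hom _ _ p₁ q₁) (A₂.hom _ _ p₂ q₂) ⟩
      (T₁ g₁ ∘ₐ T₁ h₁) ⊗ₐ (T₂ g₂ ∘ₐ T₂ h₂)     ≡⟨ ⊗ₐ-∘ₐ (T₁ g₁) (T₁ h₁) (T₂ g₂) (T₂ h₂) ⟨
      (T₁ g₁ ⊗ₐ T₂ g₂) ∘ₐ (T₁ h₁ ⊗ₐ T₂ h₂)     ≡⟨ cong₂ _∘ₐ_ (⊗ᵀ-⊗ₐ T₁ T₂ g₁ g₂) (⊗ᵀ-⊗ₐ T₁ T₂ h₁ h₂) ⟨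
      T (g₁ ⊗ₐ g₂) ∘ₐ T (h₁ ⊗ₐ h₂)             ∎
      where open ≡-Reasoning
    surjective : ∀ {h₁ h₂} → ∃[ g ] (G₁ g × T₁ g ≡ h₁) → ∃[ g ] (G₂ g × T₂ g ≡ h₂) →
                 ∃[ g ] ((G₁ ⊗ G₂) g × T g ≡ h₁ ⊗ₐ h₂)
    surjective (g₁ , p₁ , T₁g₁≡h₁) (g₂ , p₂ , T₂g₂≡h₂) =
      g₁ ⊗ₐ g₂ , (g₁ , g₂ , p₁ , p₂ , refl) , trans (⊗ᵀ-⊗ₐ T₁ T₂ g₁ g₂) (cong₂ _⊗ₐ_ T₁g₁≡h₁ T₂g₂≡h₂)

  ⊗-induces : ∀ {G₁ G₂ T₁ T₂} τ₁ τ₂ → Induces {r₁} G₁ T₁ τ₁ → Induces {r₂} G₂ T₂ τ₂ →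
              Induces (G₁ ⊗ G₂) (T₁ ⊗ᵀ T₂) (τ₁ ∣ₚ τ₂)
  ⊗-induces {T₁ = T₁} {T₂} τ₁ τ₂ I₁ I₂ _ (g₁ , g₂ , p₁ , p₂ , refl) = begin
    (τ₁ ∣ₚ τ₂) (act (g₁ ⊗ₐ g₂) 𝟎)
      ≡⟨ cong (τ₁ ∣ₚ τ₂) (act-⊗ₐ-𝟎 g₁ g₂) ⟩
    (τ₁ ∣ₚ τ₂) (act g₁ 𝟎 ++ act g₂ 𝟎)
      ≡⟨ cong₂ (λ u v → τ₁ u ++ τ₂ v) (take-++ (act g₁ 𝟎) _) (drop-++ (act g₁ 𝟎) _) ⟩
    τ₁ (act g₁ 𝟎) ++ τ₂ (act g₂ 𝟎)
      ≡⟨ cong₂ _++_ (I₁ g₁ p₁) (I₂ g₂ p₂) ⟩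
    act (T₁ g₁) 𝟎 ++ act (T₂ g₂) 𝟎
      ≡⟨ act-⊗ₐ-𝟎 (T₁ g₁) (T₂ g₂) ⟨
    act (T₁ g₁ ⊗ₐ T₂ g₂) 𝟎
      ≡⟨ cong (λ g → act g 𝟎) (⊗ᵀ-⊗ₐ T₁ T₂ g₁ g₂) ⟨
    act ((T₁ ⊗ᵀ T₂) (g₁ ⊗ₐ g₂)) 𝟎 ∎
    where open ≡-Reasoning

module Enumeration (F : FiniteField) where
  open FiniteField F using (elements; complete; unique)
  open Over F

  allVecs-suc : ∀ r → allVecs (suc r) ≡ List.cartesianProductWith _∷_ elements (allVecs r)
  allVecs-suc r = concatMap-map≡cartesianProductWith _∷_ elements (allVecs r)

  allVecs-complete : ∀ r (v : V r) → v ∈ allVecs r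
  allVecs-complete zero    []      = Any.here refl
  allVecs-complete (suc r) (x ∷ v) =
    subst (x ∷ v ∈_) (sym (allVecs-suc r)) (∈-cartesianProductWith⁺ _∷_ (complete x) (allVecs-complete r v))

  allVecs-unique : ∀ r → Unique (allVecs r)
  allVecs-unique zero    = All.[] AllPairs.∷ AllPairs.[]
  allVecs-unique (suc r) =
    subst Unique (sym (allVecs-suc r)) (Unique.cartesianProductWith⁺ _∷_ ∷-injective unique (allVecs-unique r))

  index : ∀ {r} → V r → Fin (Q r)
  index {r} v = Any.index (allVecs-complete r v)

  pos≡lookup : ∀ {r} (i : Fin (Q r)) → pos {r} i ≡ List.lookup (allVecs r) i
  pos≡lookup {r} = lookup-fromList (allVecs r)

  pos-index : ∀ {r} (v : V r) → pos (index v) ≡ v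
  pos-index {r} v = trans (pos≡lookup (index v)) (sym (lookup-index (allVecs-complete r v)))

  pos-injective : ∀ {r} (i j : Fin (Q r)) → pos {r} i ≡ pos j → i ≡ j
  pos-injective {r} i j eq =
    lookup-injective (allVecs-unique r) i j (trans (sym (pos≡lookup i)) (trans eq (pos≡lookup j)))

  index-pos : ∀ {r} (i : Fin (Q r)) → index (pos {r} i) ≡ i
  index-pos {r} i = pos-injective _ _ (pos-index (pos {r} i))

module Hamming (F : FiniteField) where
  open FiniteField F using (_+ᶠ_; _*ᶠ_; _≟_)
  open Over F
  open Scalars F using (+-cancelˡ; *-cancelˡ-nonZero)
  open Vectors F

  module ℕ-Sum = CommutativeMonoidSum ℕ.+-0-commutativeMonoid

  mismatch : Carrier → Carrier → ℕ
  mismatch a b = if does (a ≟ b) then 0 else 1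

  mismatch-cong : ∀ {a b a′ b′} → (a ≡ b → a′ ≡ b′) → (a′ ≡ b′ → a ≡ b) → mismatch a b ≡ mismatch a′ b′
  mismatch-cong {a} {b} {a′} {b′} to from with a ≟ b | a′ ≟ b′
  ... | yes _   | yes _     = refl
  ... | yes a≡b | no a′≢b′  = ⊥-elim (a′≢b′ (to a≡b))
  ... | no a≢b  | yes a′≡b′ = ⊥-elim (a≢b (from a′≡b′))
  ... | no _    | no _      = refl

  dist≡∑ : ∀ {N} (x y : Vec Carrier N) → dist x y ≡ ℕ-Sum.sum (λ i → mismatch (lookup x i) (lookup y i))
  dist≡∑ []       []       = refl
  dist≡∑ (x ∷ xs) (y ∷ ys) = cong (mismatch x y +_) (dist≡∑ xs ys)

  dist-++ : ∀ {m n} (a c : Vec Carrier m) (b d : Vec Carrier n) → dist (a ++ b) (c ++ d) ≡ dist a c + dist b d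
  dist-++ []      []      b d = refl
  dist-++ (x ∷ a) (y ∷ c) b d = trans (cong (mismatch x y +_) (dist-++ a c b d)) (sym (ℕ.+-assoc (mismatch x y) _ _))

  dist-⊕ˡ : ∀ {N} (s x y : Vec Carrier N) → dist (s ⊕ x) (s ⊕ y) ≡ dist x y
  dist-⊕ˡ []       []       []       = refl
  dist-⊕ˡ (s ∷ ss) (x ∷ xs) (y ∷ ys) = cong₂ _+_ (mismatch-cong (+-cancelˡ s x y) (cong (s +ᶠ_))) (dist-⊕ˡ ss xs ys)

  dist-permute : ∀ {n} (π π⁻¹ : Fin n → Fin n) → (∀ i → π (π⁻¹ i) ≡ i) → (∀ i → π⁻¹ (π i) ≡ i) →
                 ∀ x y → dist (permute π x) (permute π y) ≡ dist x y
  dist-permute π π⁻¹ ππ⁻¹ π⁻¹π x y = begin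
    dist (permute π x) (permute π y)
      ≡⟨ dist≡∑ (permute π x) (permute π y) ⟩
    ℕ-Sum.sum (λ i → mismatch (lookup (permute π x) i) (lookup (permute π y) i))
      ≡⟨ ℕ-Sum.sum-cong-≗ (λ i → cong₂ mismatch (lookup∘tabulate (lookup x ∘ π) i) (lookup∘tabulate (lookup y ∘ π) i)) ⟩
    ℕ-Sum.sum (λ i → mismatch (lookup x (π i)) (lookup y (π i)))
      ≡⟨ ℕ-Sum.sum-permute _ (permutation π π⁻¹ ππ⁻¹ π⁻¹π) ⟨
    ℕ-Sum.sum (λ i → mismatch (lookup x i) (lookup y i))
      ≡⟨ dist≡∑ x y ⟨
    dist x y ∎
    where open ≡-Reasoning

  dist-rescale : ∀ {n} (c : Fin n → Carrier) → (∀ k → c k ≢ 0#) → ∀ x y → dist (rescale c x) (rescale c y) ≡ dist x y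
  dist-rescale c c≢0 x y = begin
    dist (rescale c x) (rescale c y)                                        ≡⟨ dist≡∑ (rescale c x) (rescale c y) ⟩
    ℕ-Sum.sum (λ i → mismatch (lookup (rescale c x) i) (lookup (rescale c y) i))
      ≡⟨ ℕ-Sum.sum-cong-≗ (λ i → cong₂ mismatch (lookup∘tabulate (λ k → c k *ᶠ lookup x k) i)
                                                  (lookup∘tabulate (λ k → c k *ᶠ lookup y k) i)) ⟩
    ℕ-Sum.sum (λ i → mismatch (c i *ᶠ lookup x i) (c i *ᶠ lookup y i))
      ≡⟨ ℕ-Sum.sum-cong-≗ (λ i → mismatch-cong (*-cancelˡ-nonZero _ _ _ (c≢0 i)) (cong (c i *ᶠ_))) ⟩
    ℕ-Sum.sum (λ i → mismatch (lookup x i) (lookup y i))                    ≡⟨ dist≡∑ x y ⟨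
    dist x y                                                                ∎
    where open ≡-Reasoning

module DCosets (F : FiniteField) where
  open FiniteField F using (_+ᶠ_; _*ᶠ_; -ᶠ_; _≟_)
  open Over F
  open Scalars F
  open Vectors F
  open Matrices F
  open Enumeration F
  open Hamming F using (dist-permute)

  weight : ∀ {N} → Vec Carrier N → Carrier
  weight y = foldr _ _+ᶠ_ 0# y

  moment : ∀ {r} → Vec Carrier (Q r) → V r
  moment {r} y = foldr _ _⊕_ 𝟎 (tabulate (λ i → lookup y i • pos {r} i))

  -- D r y unfolds to weight y ≡ 0# × moment y ≡ 𝟎, and D_u is the coset of D cut out by moment y ≡ -u.
  record DCoset (r : ℕ) (u : V r) (y : Vec Carrier (Q r)) : Set where
    constructor dcoset
    field
      weight≡0 : weight y ≡ 0#
      moment≡⊖ : moment {r} y ≡ ⊖ u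

  lookup-moment : ∀ {r} (y : Vec Carrier (Q r)) k → lookup (moment y) k ≡ ∑ (λ i → lookup y i *ᶠ lookup (pos {r} i) k)
  lookup-moment {r} y k = trans (lookup-foldr-⊕ (tabulate (λ i → lookup y i • pos {r} i)) k)
    (∑-cong (λ i → trans (cong (λ w → lookup w k) (lookup∘tabulate (λ i → lookup y i • pos {r} i) i))
                         (lookup-• (lookup y i) (pos {r} i) k)))

  weight-⊕ : ∀ {N} (y y′ : Vec Carrier N) → weight (y ⊕ y′) ≡ weight y +ᶠ weight y′
  weight-⊕ y y′ = begin
    weight (y ⊕ y′)                           ≡⟨ foldr-+≡∑ (y ⊕ y′) ⟩
    ∑ (lookup (y ⊕ y′))                       ≡⟨ ∑-cong (lookup-⊕ y y′) ⟩
    ∑ (λ i → lookup y i +ᶠ lookup y′ i)       ≡⟨ ∑-+ (lookup y) (lookup y′) ⟩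
    ∑ (lookup y) +ᶠ ∑ (lookup y′)             ≡⟨ cong₂ _+ᶠ_ (foldr-+≡∑ y) (foldr-+≡∑ y′) ⟨
    weight y +ᶠ weight y′                     ∎
    where open ≡-Reasoning

  weight-⊖ : ∀ {N} (y : Vec Carrier N) → weight (⊖ y) ≡ -ᶠ weight y
  weight-⊖ y = begin
    weight (⊖ y)             ≡⟨ foldr-+≡∑ (⊖ y) ⟩
    ∑ (lookup (⊖ y))         ≡⟨ ∑-cong (lookup-⊖ y) ⟩
    ∑ (λ i → -ᶠ lookup y i)  ≡⟨ ∑-neg (lookup y) ⟩
    -ᶠ ∑ (lookup y)          ≡⟨ cong -ᶠ_ (foldr-+≡∑ y) ⟨
    -ᶠ weight y              ∎
    where open ≡-Reasoning

  weight-𝟎 : ∀ {N} → weight (𝟎 {N}) ≡ 0#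
  weight-𝟎 {N} = trans (foldr-+≡∑ (𝟎 {N})) (∑-zero _ lookup-𝟎)

  moment-⊕ : ∀ {r} (y y′ : Vec Carrier (Q r)) → moment (y ⊕ y′) ≡ moment y ⊕ moment y′
  moment-⊕ {r} y y′ = lookup-ext λ k → begin
    lookup (moment (y ⊕ y′)) k
      ≡⟨ lookup-moment (y ⊕ y′) k ⟩
    ∑ (λ i → lookup (y ⊕ y′) i *ᶠ p i k)
      ≡⟨ ∑-cong (λ i → trans (cong (_*ᶠ p i k) (lookup-⊕ y y′ i)) (distribʳ _ _ _)) ⟩
    ∑ (λ i → lookup y i *ᶠ p i k +ᶠ lookup y′ i *ᶠ p i k)
      ≡⟨ ∑-+ _ _ ⟩
    ∑ (λ i → lookup y i *ᶠ p i k) +ᶠ ∑ (λ i → lookup y′ i *ᶠ p i k)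
      ≡⟨ cong₂ _+ᶠ_ (lookup-moment y k) (lookup-moment y′ k) ⟨
    lookup (moment y) k +ᶠ lookup (moment y′) k
      ≡⟨ lookup-⊕ (moment y) (moment y′) k ⟨
    lookup (moment y ⊕ moment y′) k ∎
    where
    open ≡-Reasoning
    p : Fin (Q r) → Fin r → Carrier
    p i k = lookup (pos {r} i) k

  moment-⊖ : ∀ {r} (y : Vec Carrier (Q r)) → moment (⊖ y) ≡ ⊖ moment y
  moment-⊖ {r} = additive-⊖ (moment {r}) (moment-⊕ {r})

  moment-𝟎 : ∀ {r} → moment {r} 𝟎 ≡ 𝟎
  moment-𝟎 {r} = additive-𝟎 (moment {r}) (moment-⊕ {r})

  lookup-e : ∀ {r} (c : V r) i → lookup (e c) i ≡ (if does (≡-dec _≟_ (pos {r} i) c) then 1# else 0#)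
  lookup-e {r} c i = lookup∘tabulate _ i

  lookup-e-index : ∀ {r} (c : V r) → lookup (e c) (index c) ≡ 1#
  lookup-e-index {r} c with ≡-dec _≟_ (pos {r} (index c)) c | lookup-e c (index c)
  ... | yes _   | eq = eq
  ... | no  p≢c | _  = ⊥-elim (p≢c (pos-index c))

  lookup-e-other : ∀ {r} (c : V r) i → i ≢ index c → lookup (e c) i ≡ 0#
  lookup-e-other {r} c i i≢c with ≡-dec _≟_ (pos {r} i) c | lookup-e c i
  ... | yes p≡c | _  = ⊥-elim (i≢c (trans (sym (index-pos i)) (cong index p≡c)))
  ... | no  _   | eq = eq

  weight-e : ∀ {r} (c : V r) → weight (e c) ≡ 1#
  weight-e c = trans (foldr-+≡∑ (e c)) (trans (∑-supported-at _ (index c) (lookup-e-other c)) (lookup-e-index c))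

  moment-e : ∀ {r} (c : V r) → moment (e c) ≡ c
  moment-e {r} c = lookup-ext λ k → begin
    lookup (moment (e c)) k
      ≡⟨ lookup-moment (e c) k ⟩
    ∑ (λ i → lookup (e c) i *ᶠ lookup (pos {r} i) k)
      ≡⟨ ∑-supported-at _ (index c) (λ i i≢c → trans (cong (_*ᶠ _) (lookup-e-other c i i≢c)) (zeroˡ _)) ⟩
    lookup (e c) (index c) *ᶠ lookup (pos (index c)) k
      ≡⟨ cong₂ (λ x v → x *ᶠ lookup v k) (lookup-e-index c) (pos-index c) ⟩
    1# *ᶠ lookup c k
      ≡⟨ *-identityˡ _ ⟩
    lookup c k ∎
    where open ≡-Reasoning

  DCoset-⊕ : ∀ {r u v y y′} → DCoset r u y → DCoset r v y′ → DCoset r (u ⊕ v) (y ⊕ y′)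
  DCoset-⊕ {u = u} {v} {y} {y′} (dcoset wy my) (dcoset wy′ my′) = dcoset
    (trans (weight-⊕ y y′) (trans (cong₂ _+ᶠ_ wy wy′) (+-identityˡ 0#)))
    (trans (moment-⊕ y y′) (trans (cong₂ _⊕_ my my′) (⊖-⊕ u v)))

  DCoset-⊖ : ∀ {r u y} → DCoset r u y → DCoset r (⊖ u) (⊖ y)
  DCoset-⊖ {y = y} (dcoset wy my) = dcoset (trans (weight-⊖ y) (trans (cong -ᶠ_ wy) -0#≈0#)) (trans (moment-⊖ y) (cong ⊖_ my))

  DCoset-𝟎 : ∀ {r} → DCoset r 𝟎 𝟎
  DCoset-𝟎 {r} = dcoset (weight-𝟎 {Q r}) (trans (moment-𝟎 {r}) (sym ⊖-𝟎))

  shift : ∀ {r} → V r → Vec Carrier (Q r)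
  shift {r} u = e {r} 𝟎 ⊕ (⊖ e u)

  DCoset-shift : ∀ {r} (u : V r) → DCoset r u (shift u)
  DCoset-shift {r} u = dcoset
    (trans (weight-⊕ (e {r} 𝟎) (⊖ e u))
      (trans (cong₂ _+ᶠ_ (weight-e {r} 𝟎) (trans (weight-⊖ (e u)) (cong -ᶠ_ (weight-e u)))) (-‿inverseʳ 1#)))
    (trans (moment-⊕ (e {r} 𝟎) (⊖ e u))
      (trans (cong₂ _⊕_ (moment-e {r} 𝟎) (trans (moment-⊖ (e u)) (cong ⊖_ (moment-e u)))) (⊕-identityˡ _)))

  D⇒DCoset-𝟎 : ∀ {r y} → D r y → DCoset r 𝟎 y
  D⇒DCoset-𝟎 (wy , my) = dcoset wy (trans my (sym ⊖-𝟎))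

  DCoset-𝟎⇒D : ∀ {r y} → DCoset r 𝟎 y → D r y
  DCoset-𝟎⇒D (dcoset wy my) = wy , trans my ⊖-𝟎

  Dₐ⇒DCoset : ∀ {r} u y → Dₐ r u y → DCoset r u y
  Dₐ⇒DCoset {r} u _ (d , d∈D , refl) =
    subst₂ (DCoset r) (⊕-identityˡ u) (sym (⊕-assoc d (e {r} 𝟎) (⊖ e u))) (DCoset-⊕ (D⇒DCoset-𝟎 d∈D) (DCoset-shift u))

  DCoset⇒Dₐ : ∀ {r} u y → DCoset r u y → Dₐ r u y
  DCoset⇒Dₐ {r} u y y∈Du = d , DCoset-𝟎⇒D d∈D𝟎 , y≡d+shift
    where
    d : Vec Carrier (Q r)
    d = y ⊕ (⊖ shift u)
    d∈D𝟎 : DCoset r 𝟎 d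
    d∈D𝟎 = subst (λ v → DCoset r v d) (⊕-inverseʳ u) (DCoset-⊕ y∈Du (DCoset-⊖ (DCoset-shift u)))
    y≡d+shift : y ≡ (d ⊕ e {r} 𝟎) ⊕ (⊖ e u)
    y≡d+shift = begin
      y                                ≡⟨ ⊕-identityʳ y ⟨
      y ⊕ 𝟎                            ≡⟨ cong (y ⊕_) (⊕-inverseˡ (shift u)) ⟨
      y ⊕ ((⊖ shift u) ⊕ shift u)      ≡⟨ ⊕-assoc y _ _ ⟨
      d ⊕ shift u                      ≡⟨ ⊕-assoc d (e {r} 𝟎) (⊖ e u) ⟨
      (d ⊕ e {r} 𝟎) ⊕ (⊖ e u)              ∎
      where open ≡-Reasoning

  relabel : ∀ {r} → (V r → V r) → Vec Carrier (Q r) → Vec Carrier (Q r)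
  relabel {r} f = permute (λ i → index (f (pos {r} i)))

  relabel-index-inverse : ∀ {r} (f g : V r → V r) → (∀ v → f (g v) ≡ v) →
                          ∀ i → index (f (pos (index (g (pos {r} i))))) ≡ i
  relabel-index-inverse {r} f g fg i = trans (cong (index ∘ f) (pos-index (g (pos {r} i)))) (trans (cong index (fg (pos i))) (index-pos i))

  lookup-relabel : ∀ {r} (f : V r → V r) y i → lookup (relabel f y) i ≡ lookup y (index (f (pos {r} i)))
  lookup-relabel f y i = lookup∘tabulate _ i

  relabel-∘ : ∀ {r} (f g : V r → V r) y → relabel f (relabel g y) ≡ relabel (g ∘ f) y
  relabel-∘ {r} f g y = lookup-ext λ i → begin
    lookup (relabel f (relabel g y)) i
      ≡⟨ lookup-relabel f (relabel g y) i ⟩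
    lookup (relabel g y) (index (f (pos {r} i)))
      ≡⟨ lookup-relabel g y _ ⟩
    lookup y (index (g (pos (index (f (pos {r} i))))))
      ≡⟨ cong (λ v → lookup y (index (g v))) (pos-index (f (pos i))) ⟩
    lookup y (index (g (f (pos {r} i))))
      ≡⟨ lookup-relabel (g ∘ f) y i ⟨
    lookup (relabel (g ∘ f) y) i ∎
    where open ≡-Reasoning

  relabel-cong : ∀ {r} {f g : V r → V r} → (∀ v → f v ≡ g v) → ∀ y → relabel f y ≡ relabel g y
  relabel-cong {f = f} {g} f≗g y =
    lookup-ext λ i → trans (lookup-relabel f y i) (trans (cong (lookup y ∘ index) (f≗g _)) (sym (lookup-relabel g y i)))

  relabel-id : ∀ {r} (y : Vec Carrier (Q r)) → relabel {r} id y ≡ y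
  relabel-id {r} y = lookup-ext λ i → trans (lookup-relabel {r} id y i) (cong (lookup y) (index-pos {r} i))

  module _ {r : ℕ} (N N′ : Mat r r) (NN′ : ∀ v → N ·ᵥ (N′ ·ᵥ v) ≡ v) (N′N : ∀ v → N′ ·ᵥ (N ·ᵥ v) ≡ v) where
    private
      p q : Fin (Q r) → Fin (Q r)
      p i = index (N′ ·ᵥ pos {r} i)
      q i = index (N ·ᵥ pos {r} i)
      pq : ∀ i → p (q i) ≡ i
      pq = relabel-index-inverse (N′ ·ᵥ_) (N ·ᵥ_) N′N
      qp : ∀ i → q (p i) ≡ i
      qp = relabel-index-inverse (N ·ᵥ_) (N′ ·ᵥ_) NN′

    weight-relabel : ∀ y → weight (relabel (N′ ·ᵥ_) y) ≡ weight y
    weight-relabel y = begin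
      weight (relabel (N′ ·ᵥ_) y)               ≡⟨ foldr-+≡∑ (relabel (N′ ·ᵥ_) y) ⟩
      ∑ (lookup (relabel (N′ ·ᵥ_) y))           ≡⟨ ∑-reindex _ q p qp pq ⟩
      ∑ (lookup (relabel (N′ ·ᵥ_) y) ∘ q)
        ≡⟨ ∑-cong (λ i → trans (lookup-relabel (N′ ·ᵥ_) y (q i)) (cong (lookup y) (pq i))) ⟩
      ∑ (lookup y)                              ≡⟨ foldr-+≡∑ y ⟨
      weight y                                  ∎
      where open ≡-Reasoning

    moment-relabel : ∀ y → moment (relabel (N′ ·ᵥ_) y) ≡ N ·ᵥ moment y
    moment-relabel y = lookup-ext λ k → begin
      lookup (moment (relabel (N′ ·ᵥ_) y)) k
        ≡⟨ lookup-moment (relabel (N′ ·ᵥ_) y) k ⟩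
      ∑ (λ i → lookup y′ i *ᶠ lookup (pos {r} i) k)
        ≡⟨ ∑-reindex _ q p qp pq ⟩
      ∑ (λ i → lookup y′ (q i) *ᶠ lookup (pos {r} (q i)) k)
        ≡⟨ ∑-cong (λ i → cong₂ (λ a v → a *ᶠ lookup v k) (trans (lookup-relabel (N′ ·ᵥ_) y (q i)) (cong (lookup y) (pq i))) (pos-index _)) ⟩
      ∑ (λ i → lookup y i *ᶠ lookup (N ·ᵥ pos {r} i) k)
        ≡⟨ ·ᵥ-linear-combination N (lookup y) pos (moment y) (lookup-moment y) k ⟨
      lookup (N ·ᵥ moment y) k ∎
      where
      open ≡-Reasoning
      y′ : Vec Carrier (Q r)
      y′ = relabel (N′ ·ᵥ_) y

    dist-relabel : ∀ y y′ → dist (relabel (N′ ·ᵥ_) y) (relabel (N′ ·ᵥ_) y′) ≡ dist y y′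
    dist-relabel = dist-permute p q pq qp

    DCoset-relabel : ∀ {u y} → DCoset r u y → DCoset r (N ·ᵥ u) (relabel (N′ ·ᵥ_) y)
    DCoset-relabel {u} {y} (dcoset wy my) = dcoset
      (trans (weight-relabel y) wy)
      (trans (moment-relabel y) (trans (cong (N ·ᵥ_) my) (·ᵥ-⊖ N u)))

module Monomial (F : FiniteField) {r n : ℕ} (cols : Vec (Over.V F r) n) (H : Over.IsSubspaceMatrix F cols) where
  open FiniteField F using (_+ᶠ_; _*ᶠ_)
  open Over F
  open IsSubspaceMatrix H
  open Scalars F
  open Vectors F
  open Matrices F
  open Hamming F

  col : Fin n → V r
  col j = lookup cols j

  lookup-syndrome : ∀ x k → lookup (syndrome cols x) k ≡ ∑ (λ j → lookup x j *ᶠ lookup (col j) k)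
  lookup-syndrome x k = trans (lookup-foldr-⊕ (zipWith _•_ x cols) k)
    (∑-cong (λ j → trans (cong (λ w → lookup w k) (lookup-zipWith _•_ j x cols)) (lookup-• (lookup x j) (col j) k)))

  syndrome-⊕ : ∀ x y → syndrome cols (x ⊕ y) ≡ syndrome cols x ⊕ syndrome cols y
  syndrome-⊕ x y = lookup-ext λ k → begin
    lookup (syndrome cols (x ⊕ y)) k                                   ≡⟨ lookup-syndrome (x ⊕ y) k ⟩
    ∑ (λ j → lookup (x ⊕ y) j *ᶠ lookup (col j) k)
      ≡⟨ ∑-cong (λ j → trans (cong (_*ᶠ lookup (col j) k) (lookup-⊕ x y j)) (distribʳ _ _ _)) ⟩
    ∑ (λ j → lookup x j *ᶠ lookup (col j) k +ᶠ lookup y j *ᶠ lookup (col j) k) ≡⟨ ∑-+ _ _ ⟩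
    ∑ (λ j → lookup x j *ᶠ lookup (col j) k) +ᶠ ∑ (λ j → lookup y j *ᶠ lookup (col j) k)
      ≡⟨ cong₂ _+ᶠ_ (lookup-syndrome x k) (lookup-syndrome y k) ⟨
    lookup (syndrome cols x) k +ᶠ lookup (syndrome cols y) k           ≡⟨ lookup-⊕ (syndrome cols x) _ k ⟨
    lookup (syndrome cols x ⊕ syndrome cols y) k                       ∎
    where open ≡-Reasoning

  syndrome-⊖ : ∀ x → syndrome cols (⊖ x) ≡ ⊖ syndrome cols x
  syndrome-⊖ = additive-⊖ (syndrome cols) syndrome-⊕

  syndrome-𝟎 : syndrome cols 𝟎 ≡ 𝟎
  syndrome-𝟎 = additive-𝟎 (syndrome cols) syndrome-⊕

  module ColumnImage (M : Mat r r) (M-injective : ∀ u v → M ·ᵥ u ≡ M ·ᵥ v → u ≡ v) where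
    M·col≢𝟎 : ∀ j → M ·ᵥ col j ≢ 𝟎
    M·col≢𝟎 j eq = nonzero j (M-injective _ _ (trans eq (sym (·ᵥ-𝟎 M))))

    σ : Fin n → Fin n
    σ j = proj₁ (covers (M ·ᵥ col j) (M·col≢𝟎 j))

    coef : Fin n → Carrier
    coef j = proj₁ (proj₂ (covers (M ·ᵥ col j) (M·col≢𝟎 j)))

    M·col : ∀ j → M ·ᵥ col j ≡ coef j • col (σ j)
    M·col j = proj₂ (proj₂ (covers (M ·ᵥ col j) (M·col≢𝟎 j)))

    M·col-unique : ∀ j s c → M ·ᵥ col j ≡ c • col s → s ≡ σ j × c ≡ coef j
    M·col-unique j s c eq = s≡σj , •-cancelʳ-nonZero (col (σ j)) c (coef j) (nonzero (σ j))
      (trans (cong (λ t → c • col t) (sym s≡σj)) (trans (sym eq) (M·col j)))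
      where
      s≡σj : s ≡ σ j
      s≡σj = distinct (M ·ᵥ col j) s (σ j) c (coef j) (M·col≢𝟎 j) eq (M·col j)

    coef-nonZero : ∀ j → coef j ≢ 0#
    coef-nonZero j coef≡0 = M·col≢𝟎 j (trans (M·col j) (trans (cong (_• col (σ j)) coef≡0) (•-zeroˡ _)))

  module _ (M M′ : Mat r r)
           (M-injective : ∀ u v → M ·ᵥ u ≡ M ·ᵥ v → u ≡ v) (M′-injective : ∀ u v → M′ ·ᵥ u ≡ M′ ·ᵥ v → u ≡ v)
           (MM′ : ∀ v → M ·ᵥ (M′ ·ᵥ v) ≡ v) where
    private
      module C = ColumnImage M M-injective
      module C′ = ColumnImage M′ M′-injective

    σ-inverse : ∀ k → C.σ (C′.σ k) ≡ k
    σ-inverse k = sym (distinct (col k) k (C.σ (C′.σ k)) 1# (C′.coef k *ᶠ C.coef (C′.σ k)) (nonzero k) (sym (•-identityˡ _)) (begin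
      col k                                                ≡⟨ MM′ (col k) ⟨
      M ·ᵥ (M′ ·ᵥ col k)                                   ≡⟨ cong (M ·ᵥ_) (C′.M·col k) ⟩
      M ·ᵥ (C′.coef k • col (C′.σ k))                      ≡⟨ ·ᵥ-• M _ _ ⟩
      C′.coef k • (M ·ᵥ col (C′.σ k))                      ≡⟨ cong (C′.coef k •_) (C.M·col (C′.σ k)) ⟩
      C′.coef k • (C.coef (C′.σ k) • col (C.σ (C′.σ k)))  ≡⟨ •-assoc _ _ _ ⟩
      (C′.coef k *ᶠ C.coef (C′.σ k)) • col (C.σ (C′.σ k)) ∎))
      where open ≡-Reasoning

  module Induced (M M′ : Mat r r) (MM′ : ∀ v → M ·ᵥ (M′ ·ᵥ v) ≡ v) (M′M : ∀ v → M′ ·ᵥ (M ·ᵥ v) ≡ v) where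
    M-injective : ∀ u v → M ·ᵥ u ≡ M ·ᵥ v → u ≡ v
    M-injective u v eq = trans (sym (M′M u)) (trans (cong (M′ ·ᵥ_) eq) (M′M v))

    M′-injective : ∀ u v → M′ ·ᵥ u ≡ M′ ·ᵥ v → u ≡ v
    M′-injective u v eq = trans (sym (MM′ u)) (trans (cong (M ·ᵥ_) eq) (MM′ v))

    open ColumnImage M M-injective public

    ρ : Fin n → Fin n
    ρ = ColumnImage.σ M′ M′-injective

    σ-ρ : ∀ k → σ (ρ k) ≡ k
    σ-ρ = σ-inverse M M′ M-injective M′-injective MM′

    ρ-σ : ∀ j → ρ (σ j) ≡ j
    ρ-σ = σ-inverse M′ M M′-injective M-injective M′M

    μ : V n → V n
    μ x = rescale (coef ∘ ρ) (permute ρ x)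

    lookup-μ-σ : ∀ x j → lookup (μ x) (σ j) ≡ coef j *ᶠ lookup x j
    lookup-μ-σ x j = begin
      lookup (μ x) (σ j)                         ≡⟨ lookup∘tabulate _ (σ j) ⟩
      coef (ρ (σ j)) *ᶠ lookup (permute ρ x) (σ j) ≡⟨ cong (coef (ρ (σ j)) *ᶠ_) (lookup∘tabulate _ (σ j)) ⟩
      coef (ρ (σ j)) *ᶠ lookup x (ρ (σ j))       ≡⟨ cong (λ t → coef t *ᶠ lookup x t) (ρ-σ j) ⟩
      coef j *ᶠ lookup x j                       ∎
      where open ≡-Reasoning

    μ-spec : ∀ (s : Fin n → Fin n) (c : Fin n → Carrier) → (∀ j → M ·ᵥ col j ≡ c j • col (s j)) →
             ∀ x j → lookup (μ x) (s j) ≡ c j *ᶠ lookup x j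
    μ-spec s c M·col≡ x j with M·col-unique j (s j) (c j) (M·col≡ j)
    ... | s≡σ , c≡coef = trans (cong (lookup (μ x)) s≡σ) (trans (lookup-μ-σ x j) (cong (_*ᶠ lookup x j) (sym c≡coef)))

    ext-σ : ∀ (w w′ : V n) → (∀ j → lookup w (σ j) ≡ lookup w′ (σ j)) → w ≡ w′
    ext-σ w w′ h = lookup-ext λ k → trans (cong (lookup w) (sym (σ-ρ k))) (trans (h (ρ k)) (cong (lookup w′) (σ-ρ k)))

    μ-⊕ : ∀ x y → μ (x ⊕ y) ≡ μ x ⊕ μ y
    μ-⊕ x y = trans (cong (rescale (coef ∘ ρ)) (permute-⊕ ρ x y)) (rescale-⊕ (coef ∘ ρ) (permute ρ x) (permute ρ y))

    μ-𝟎 : μ 𝟎 ≡ 𝟎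
    μ-𝟎 = additive-𝟎 μ μ-⊕

    dist-μ : ∀ x y → dist (μ x) (μ y) ≡ dist x y
    dist-μ x y = trans (dist-rescale (coef ∘ ρ) (coef-nonZero ∘ ρ) (permute ρ x) (permute ρ y)) (dist-permute ρ σ ρ-σ σ-ρ x y)

    syndrome-μ : ∀ x → syndrome cols (μ x) ≡ M ·ᵥ syndrome cols x
    syndrome-μ x = lookup-ext λ k → begin
      lookup (syndrome cols (μ x)) k
        ≡⟨ lookup-syndrome (μ x) k ⟩
      ∑ (λ i → lookup (μ x) i *ᶠ lookup (col i) k)
        ≡⟨ ∑-reindex _ σ ρ σ-ρ ρ-σ ⟩
      ∑ (λ j → lookup (μ x) (σ j) *ᶠ lookup (col (σ j)) k)
        ≡⟨ ∑-cong (λ j → cong (_*ᶠ lookup (col (σ j)) k) (lookup-μ-σ x j)) ⟩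
      ∑ (λ j → (coef j *ᶠ lookup x j) *ᶠ lookup (col (σ j)) k)
        ≡⟨ ∑-cong (λ j → trans (cong (_*ᶠ lookup (col (σ j)) k) (*-comm _ _)) (*-assoc _ _ _)) ⟩
      ∑ (λ j → lookup x j *ᶠ (coef j *ᶠ lookup (col (σ j)) k))
        ≡⟨ ∑-cong (λ j → cong (lookup x j *ᶠ_) (trans (sym (lookup-• (coef j) (col (σ j)) k)) (cong (λ v → lookup v k) (sym (M·col j))))) ⟩
      ∑ (λ j → lookup x j *ᶠ lookup (M ·ᵥ col j) k)
        ≡⟨ ·ᵥ-linear-combination M (lookup x) col (syndrome cols x) (lookup-syndrome x) k ⟨
      lookup (M ·ᵥ syndrome cols x) k ∎
      where open ≡-Reasoning

module RegularGroup (F : FiniteField) {r : ℕ} (G : Over.Aff F r → Set) (reg : Over.IsRegularSubgroup F G) where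
  open Over F
  open Vectors F
  open Matrices F
  open Affine F
  open IsSubgroupGA (proj₁ reg)

  g⟨_⟩ : V r → Aff r
  g⟨ a ⟩ = proj₁ (proj₁ (proj₂ reg) a)

  g⟨⟩∈G : ∀ a → G g⟨ a ⟩
  g⟨⟩∈G a = proj₁ (proj₂ (proj₁ (proj₂ reg) a))

  g⟨⟩-𝟎 : ∀ a → act g⟨ a ⟩ 𝟎 ≡ a
  g⟨⟩-𝟎 a = proj₂ (proj₂ (proj₁ (proj₂ reg) a))

  g⟨⟩-unique : ∀ g a → G g → act g 𝟎 ≡ a → g⟨ a ⟩ ≡ g
  g⟨⟩-unique g a g∈G g𝟎≡a = proj₂ (proj₂ reg) _ _ (g⟨⟩∈G a) g∈G (trans (g⟨⟩-𝟎 a) (sym g𝟎≡a))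

  linearPart : V r → Mat r r
  linearPart a = proj₂ g⟨ a ⟩

  linearPart⁻¹ : V r → Mat r r
  linearPart⁻¹ a = proj₁ (inGA g⟨ a ⟩ (g⟨⟩∈G a))

  linearPart-inverseʳ : ∀ a v → linearPart a ·ᵥ (linearPart⁻¹ a ·ᵥ v) ≡ v
  linearPart-inverseʳ a v = trans (sym (·ₘ-·ᵥ-assoc (linearPart a) (linearPart⁻¹ a) v))
    (trans (cong (_·ᵥ v) (proj₁ (proj₂ (inGA g⟨ a ⟩ (g⟨⟩∈G a))))) (Iₘ-·ᵥ v))

  linearPart-inverseˡ : ∀ a v → linearPart⁻¹ a ·ᵥ (linearPart a ·ᵥ v) ≡ v
  linearPart-inverseˡ a v = trans (sym (·ₘ-·ᵥ-assoc (linearPart⁻¹ a) (linearPart a) v))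
    (trans (cong (_·ᵥ v) (proj₂ (proj₂ (inGA g⟨ a ⟩ (g⟨⟩∈G a))))) (Iₘ-·ᵥ v))

  infixl 7 _⋆_
  infix 8 _⁻

  _⋆_ : V r → V r → V r
  a ⋆ b = act g⟨ a ⟩ b

  ⋆≡⊕ : ∀ a b → a ⋆ b ≡ a ⊕ (linearPart a ·ᵥ b)
  ⋆≡⊕ a b = cong (_⊕ (linearPart a ·ᵥ b)) (begin
    proj₁ g⟨ a ⟩                              ≡⟨ ⊕-identityʳ _ ⟨
    proj₁ g⟨ a ⟩ ⊕ 𝟎                          ≡⟨ cong (proj₁ g⟨ a ⟩ ⊕_) (·ᵥ-𝟎 (linearPart a)) ⟨
    act g⟨ a ⟩ 𝟎                              ≡⟨ g⟨⟩-𝟎 a ⟩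
    a                                         ∎)
    where open ≡-Reasoning

  ⋆≡𝟎⇒linearPart≡⊖ : ∀ a b → a ⋆ b ≡ 𝟎 → linearPart a ·ᵥ b ≡ ⊖ a
  ⋆≡𝟎⇒linearPart≡⊖ a b a⋆b≡𝟎 = ⊕-inverseʳ-unique a _ (trans (sym (⋆≡⊕ a b)) a⋆b≡𝟎)

  g⟨⋆⟩ : ∀ a b → g⟨ a ⋆ b ⟩ ≡ g⟨ a ⟩ ∘ₐ g⟨ b ⟩
  g⟨⋆⟩ a b = g⟨⟩-unique _ (a ⋆ b) (closed _ _ (g⟨⟩∈G a) (g⟨⟩∈G b))
    (trans (act-∘ₐ g⟨ a ⟩ g⟨ b ⟩ 𝟎) (cong (act g⟨ a ⟩) (g⟨⟩-𝟎 b)))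

  linearPart-⋆ : ∀ a b v → linearPart (a ⋆ b) ·ᵥ v ≡ linearPart a ·ᵥ (linearPart b ·ᵥ v)
  linearPart-⋆ a b v = trans (cong (λ g → proj₂ g ·ᵥ v) (g⟨⋆⟩ a b)) (·ₘ-·ᵥ-assoc (linearPart a) (linearPart b) v)

  linearPart⁻¹-⋆ : ∀ a b v → linearPart⁻¹ (a ⋆ b) ·ᵥ v ≡ linearPart⁻¹ b ·ᵥ (linearPart⁻¹ a ·ᵥ v)
  linearPart⁻¹-⋆ a b v = begin
    linearPart⁻¹ (a ⋆ b) ·ᵥ v                         ≡⟨ cong (linearPart⁻¹ (a ⋆ b) ·ᵥ_) L[ab]w≡v ⟨
    linearPart⁻¹ (a ⋆ b) ·ᵥ (linearPart (a ⋆ b) ·ᵥ w) ≡⟨ linearPart-inverseˡ (a ⋆ b) w ⟩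
    w                                                 ∎
    where
    open ≡-Reasoning
    w : V r
    w = linearPart⁻¹ b ·ᵥ (linearPart⁻¹ a ·ᵥ v)
    L[ab]w≡v : linearPart (a ⋆ b) ·ᵥ w ≡ v
    L[ab]w≡v = trans (linearPart-⋆ a b w)
      (trans (cong (linearPart a ·ᵥ_) (linearPart-inverseʳ b _)) (linearPart-inverseʳ a v))

  g⟨𝟎⟩ : g⟨ 𝟎 ⟩ ≡ idₐ
  g⟨𝟎⟩ = g⟨⟩-unique idₐ 𝟎 hasId (act-idₐ 𝟎)

  linearPart-𝟎 : ∀ v → linearPart 𝟎 ·ᵥ v ≡ v
  linearPart-𝟎 v = trans (cong (λ g → proj₂ g ·ᵥ v) g⟨𝟎⟩) (Iₘ-·ᵥ v)

  linearPart⁻¹-𝟎 : ∀ v → linearPart⁻¹ 𝟎 ·ᵥ v ≡ v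
  linearPart⁻¹-𝟎 v = trans (cong (linearPart⁻¹ 𝟎 ·ᵥ_) (sym (linearPart-𝟎 v))) (linearPart-inverseˡ 𝟎 v)

  ⋆-assoc : ∀ a b c → (a ⋆ b) ⋆ c ≡ a ⋆ (b ⋆ c)
  ⋆-assoc a b c = trans (cong (λ g → act g c) (g⟨⋆⟩ a b)) (act-∘ₐ g⟨ a ⟩ g⟨ b ⟩ c)

  ⋆-identityˡ : ∀ b → 𝟎 ⋆ b ≡ b
  ⋆-identityˡ b = trans (cong (λ g → act g b) g⟨𝟎⟩) (act-idₐ b)

  _⁻ : V r → V r
  a ⁻ = act (proj₁ (inv g⟨ a ⟩ (g⟨⟩∈G a))) 𝟎

  ⋆-inverseʳ : ∀ a → a ⋆ a ⁻ ≡ 𝟎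
  ⋆-inverseʳ a with inv g⟨ a ⟩ (g⟨⟩∈G a)
  ... | h , _ , gh≡id , _ = trans (sym (act-∘ₐ g⟨ a ⟩ h 𝟎)) (trans (cong (λ g → act g 𝟎) gh≡id) (act-idₐ 𝟎))

  ⋆-inverseˡ : ∀ a → a ⁻ ⋆ a ≡ 𝟎
  ⋆-inverseˡ a with inv g⟨ a ⟩ (g⟨⟩∈G a)
  ... | h , h∈G , _ , hg≡id = begin
    act g⟨ act h 𝟎 ⟩ a              ≡⟨ cong (λ g → act g a) (g⟨⟩-unique h _ h∈G refl) ⟩
    act h a                         ≡⟨ cong (act h) (g⟨⟩-𝟎 a) ⟨
    act h (act g⟨ a ⟩ 𝟎)            ≡⟨ act-∘ₐ h g⟨ a ⟩ 𝟎 ⟨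
    act (h ∘ₐ g⟨ a ⟩) 𝟎             ≡⟨ cong (λ g → act g 𝟎) hg≡id ⟩
    act idₐ 𝟎                       ≡⟨ act-idₐ 𝟎 ⟩
    𝟎                               ∎
    where open ≡-Reasoning

  ⋆-isGroup : IsGroup _≡_ _⋆_ 𝟎 _⁻
  ⋆-isGroup = record
    { isMonoid = record
      { isSemigroup = record
        { isMagma = record { isEquivalence = isEquivalence ; ∙-cong = cong₂ _⋆_ }
        ; assoc = ⋆-assoc }
      ; identity = ⋆-identityˡ , g⟨⟩-𝟎 }
    ; inverse = ⋆-inverseˡ , ⋆-inverseʳ
    ; ⁻¹-cong = cong _⁻ }

  ⋆-group : Group 0ℓ 0ℓ
  ⋆-group = record { isGroup = ⋆-isGroup }

  open GroupProperties ⋆-group public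
    using () renaming (∙-cancelʳ to ⋆-cancelʳ; identityʳ-unique to ⋆-identityʳ-unique)

  module _ {T : Aff r → Aff r} (A : IsAutomorphism G T) {τ : V r → V r} (I : Induces G T τ) where
    private module A = IsAutomorphism A

    T-g⟨⟩ : ∀ a → T g⟨ a ⟩ ≡ g⟨ τ a ⟩
    T-g⟨⟩ a = sym (g⟨⟩-unique _ (τ a) (A.maps _ (g⟨⟩∈G a)) (trans (sym (I _ (g⟨⟩∈G a))) (cong τ (g⟨⟩-𝟎 a))))

    τ-⋆ : ∀ a b → τ (a ⋆ b) ≡ τ a ⋆ τ b
    τ-⋆ a b = begin
      τ (a ⋆ b)                       ≡⟨ cong τ (g⟨⟩-𝟎 (a ⋆ b)) ⟨
      τ (act g⟨ a ⋆ b ⟩ 𝟎)            ≡⟨ I _ (g⟨⟩∈G (a ⋆ b)) ⟩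
      act (T g⟨ a ⋆ b ⟩) 𝟎            ≡⟨ cong (λ g → act (T g) 𝟎) (g⟨⋆⟩ a b) ⟩
      act (T (g⟨ a ⟩ ∘ₐ g⟨ b ⟩)) 𝟎    ≡⟨ cong (λ g → act g 𝟎) (A.hom _ _ (g⟨⟩∈G a) (g⟨⟩∈G b)) ⟩
      act (T g⟨ a ⟩ ∘ₐ T g⟨ b ⟩) 𝟎    ≡⟨ act-∘ₐ (T g⟨ a ⟩) (T g⟨ b ⟩) 𝟎 ⟩
      act (T g⟨ a ⟩) (act (T g⟨ b ⟩) 𝟎) ≡⟨ cong₂ (λ g h → act g (act h 𝟎)) (T-g⟨⟩ a) (T-g⟨⟩ b) ⟩
      τ a ⋆ act g⟨ τ b ⟩ 𝟎            ≡⟨ cong (τ a ⋆_) (g⟨⟩-𝟎 (τ b)) ⟩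
      τ a ⋆ τ b                       ∎
      where open ≡-Reasoning

    τ-𝟎 : τ 𝟎 ≡ 𝟎
    τ-𝟎 = ⋆-identityʳ-unique (τ 𝟎) (τ 𝟎) (sym (trans (cong τ (sym (g⟨⟩-𝟎 𝟎))) (τ-⋆ 𝟎 𝟎)))

module PropelinearStructure (F : FiniteField) {r : ℕ} (G : Over.Aff F r → Set) (reg : Over.IsRegularSubgroup F G)
                   {T : Over.Aff F r → Over.Aff F r} (A : Over.IsAutomorphism F G T)
                   {τ : Over.V F r → Over.V F r} (I : Over.Induces F G T τ)
                   {n : ℕ} (cols : Vec (Over.V F r) n) (H : Over.IsSubspaceMatrix F cols) where
  open FiniteField F using (_*ᶠ_)
  open Over F
  open Scalars F using (*-assoc; *-comm; *-identityˡ)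
  open Vectors F
  open Matrices F
  open DCosets F
  open Hamming F
  open RegularGroup F G reg
  open Monomial F cols H

  private
    module Mon (a : V r) = Induced (linearPart a) (linearPart⁻¹ a) (linearPart-inverseʳ a) (linearPart-inverseˡ a)

  μ⟨_⟩ : V r → V n → V n
  μ⟨ a ⟩ = Mon.μ a

  relabel⟨_⟩ : V r → Vec Carrier (Q r) → Vec Carrier (Q r)
  relabel⟨ a ⟩ = relabel (linearPart⁻¹ a ·ᵥ_)

  μ-⋆ : ∀ a b x → μ⟨ a ⟩ (μ⟨ b ⟩ x) ≡ μ⟨ a ⋆ b ⟩ x
  μ-⋆ a b x = Mon.ext-σ (a ⋆ b) _ _ λ j → begin
    lookup (μ⟨ a ⟩ (μ⟨ b ⟩ x)) (Mon.σ (a ⋆ b) j)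
      ≡⟨ cong (lookup (μ⟨ a ⟩ (μ⟨ b ⟩ x))) (σ[ab]≡ j) ⟨
    lookup (μ⟨ a ⟩ (μ⟨ b ⟩ x)) (s j)
      ≡⟨ Mon.lookup-μ-σ a (μ⟨ b ⟩ x) (Mon.σ b j) ⟩
    Mon.coef a (Mon.σ b j) *ᶠ lookup (μ⟨ b ⟩ x) (Mon.σ b j)
      ≡⟨ cong (Mon.coef a (Mon.σ b j) *ᶠ_) (Mon.lookup-μ-σ b x j) ⟩
    Mon.coef a (Mon.σ b j) *ᶠ (Mon.coef b j *ᶠ lookup x j)
      ≡⟨ *-assoc _ _ _ ⟨
    (Mon.coef a (Mon.σ b j) *ᶠ Mon.coef b j) *ᶠ lookup x j
      ≡⟨ cong (_*ᶠ lookup x j) (*-comm _ _) ⟩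
    c j *ᶠ lookup x j
      ≡⟨ Mon.μ-spec (a ⋆ b) s c L[ab]·col x j ⟨
    lookup (μ⟨ a ⋆ b ⟩ x) (s j)
      ≡⟨ cong (lookup (μ⟨ a ⋆ b ⟩ x)) (σ[ab]≡ j) ⟩
    lookup (μ⟨ a ⋆ b ⟩ x) (Mon.σ (a ⋆ b) j) ∎
    where
    open ≡-Reasoning
    s : Fin n → Fin n
    s j = Mon.σ a (Mon.σ b j)
    c : Fin n → Carrier
    c j = Mon.coef b j *ᶠ Mon.coef a (Mon.σ b j)
    L[ab]·col : ∀ j → linearPart (a ⋆ b) ·ᵥ col j ≡ c j • col (s j)
    L[ab]·col j = begin
      linearPart (a ⋆ b) ·ᵥ col j
        ≡⟨ linearPart-⋆ a b (col j) ⟩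
      linearPart a ·ᵥ (linearPart b ·ᵥ col j)
        ≡⟨ cong (linearPart a ·ᵥ_) (Mon.M·col b j) ⟩
      linearPart a ·ᵥ (Mon.coef b j • col (Mon.σ b j))
        ≡⟨ ·ᵥ-• (linearPart a) _ _ ⟩
      Mon.coef b j • (linearPart a ·ᵥ col (Mon.σ b j))
        ≡⟨ cong (Mon.coef b j •_) (Mon.M·col a (Mon.σ b j)) ⟩
      Mon.coef b j • (Mon.coef a (Mon.σ b j) • col (s j))
        ≡⟨ •-assoc _ _ _ ⟩
      c j • col (s j) ∎
    σ[ab]≡ : ∀ j → s j ≡ Mon.σ (a ⋆ b) j
    σ[ab]≡ j = proj₁ (Mon.M·col-unique (a ⋆ b) j (s j) (c j) (L[ab]·col j))

  μ-𝟎 : ∀ x → μ⟨ 𝟎 ⟩ x ≡ x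
  μ-𝟎 x = lookup-ext λ j → trans (Mon.μ-spec 𝟎 id (λ _ → 1#) L𝟎·col x j) (*-identityˡ _)
    where
    L𝟎·col : ∀ j → linearPart 𝟎 ·ᵥ col j ≡ 1# • col j
    L𝟎·col j = trans (linearPart-𝟎 (col j)) (sym (•-identityˡ (col j)))

  relabel-⋆ : ∀ a b y → relabel⟨ a ⟩ (relabel⟨ b ⟩ y) ≡ relabel⟨ a ⋆ b ⟩ y
  relabel-⋆ a b y = trans (relabel-∘ (linearPart⁻¹ a ·ᵥ_) (linearPart⁻¹ b ·ᵥ_) y)
                          (relabel-cong (λ v → sym (linearPart⁻¹-⋆ a b v)) y)

  relabel-𝟎 : ∀ y → relabel⟨ 𝟎 ⟩ y ≡ y
  relabel-𝟎 y = trans (relabel-cong linearPart⁻¹-𝟎 y) (relabel-id y)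

  ψ⟨_⟩ : V r → Vec Carrier (Q r) → Vec Carrier (Q r)
  ψ⟨ a ⟩ = relabel⟨ τ a ⟩

  ψ-⋆ : ∀ a b y → ψ⟨ a ⟩ (ψ⟨ b ⟩ y) ≡ ψ⟨ a ⋆ b ⟩ y
  ψ-⋆ a b y = trans (relabel-⋆ (τ a) (τ b) y) (cong (λ c → relabel⟨ c ⟩ y) (sym (τ-⋆ A {τ} I a b)))

  ψ-𝟎 : ∀ y → ψ⟨ 𝟎 ⟩ y ≡ y
  ψ-𝟎 y = trans (cong (λ c → relabel⟨ c ⟩ y) (τ-𝟎 A {τ} I)) (relabel-𝟎 y)

  ψ-⊕ : ∀ a y y′ → ψ⟨ a ⟩ (y ⊕ y′) ≡ ψ⟨ a ⟩ y ⊕ ψ⟨ a ⟩ y′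
  ψ-⊕ a = permute-⊕ _

  -- (u , a) · (u′ , b) = (u ⊕ f a u′ , a ⋆ b) is the law of a semidirect product of (V m, ⊕) by (V r, ⋆).
  module Twisted {m : ℕ} (f : V r → V m → V m) (f-⊕ : ∀ a u v → f a (u ⊕ v) ≡ f a u ⊕ f a v)
                 (f-⋆ : ∀ a b v → f a (f b v) ≡ f (a ⋆ b) v) (f-𝟎 : ∀ v → f 𝟎 v ≡ v) where
    twisted-assoc : ∀ a b u u′ v → u ⊕ f a (u′ ⊕ f b v) ≡ (u ⊕ f a u′) ⊕ f (a ⋆ b) v
    twisted-assoc a b u u′ v = begin
      u ⊕ f a (u′ ⊕ f b v)          ≡⟨ cong (u ⊕_) (f-⊕ a u′ (f b v)) ⟩
      u ⊕ (f a u′ ⊕ f a (f b v))    ≡⟨ ⊕-assoc u _ _ ⟨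
      (u ⊕ f a u′) ⊕ f a (f b v)    ≡⟨ cong ((u ⊕ f a u′) ⊕_) (f-⋆ a b v) ⟩
      (u ⊕ f a u′) ⊕ f (a ⋆ b) v    ∎
      where open ≡-Reasoning

    twisted-inverseʳ : ∀ a u → u ⊕ f a (⊖ f (a ⁻) u) ≡ 𝟎
    twisted-inverseʳ a u = begin
      u ⊕ f a (⊖ f (a ⁻) u)
        ≡⟨ cong (u ⊕_) (additive-⊖ (f a) (f-⊕ a) (f (a ⁻) u)) ⟩
      u ⊕ (⊖ f a (f (a ⁻) u))
        ≡⟨ cong (λ v → u ⊕ (⊖ v)) (trans (f-⋆ a (a ⁻) u) (cong (λ c → f c u) (⋆-inverseʳ a))) ⟩
      u ⊕ (⊖ f 𝟎 u)
        ≡⟨ cong (λ v → u ⊕ (⊖ v)) (f-𝟎 u) ⟩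
      u ⊕ (⊖ u)
        ≡⟨ ⊕-inverseʳ u ⟩
      𝟎 ∎
      where open ≡-Reasoning

    twisted-identityˡ : ∀ v → 𝟎 ⊕ f 𝟎 v ≡ v
    twisted-identityˡ v = trans (⊕-identityˡ _) (f-𝟎 v)

    twisted-identityʳ : ∀ a u → u ⊕ f a 𝟎 ≡ u
    twisted-identityʳ a u = trans (cong (u ⊕_) (additive-𝟎 (f a) (f-⊕ a))) (⊕-identityʳ u)

  module TwistedX = Twisted μ⟨_⟩ Mon.μ-⊕ μ-⋆ μ-𝟎
  module TwistedY = Twisted ψ⟨_⟩ ψ-⊕ ψ-⋆ ψ-𝟎

  W : Set
  W = Vec Carrier (n + Q r)

  xPart : W → V n
  xPart = take n

  yPart : W → Vec Carrier (Q r)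
  yPart = drop n

  syn : W → V r
  syn z = syndrome cols (xPart z)

  split : ∀ z → xPart z ++ yPart z ≡ z
  split = take++drop≡id n

  InS : W → Set
  InS z = DCoset r (τ (syn z)) (yPart z)

  S⇒InS : ∀ z → S cols τ z → InS z
  S⇒InS _ (a , x , y , syn[x]≡a , y∈D , refl) =
    subst₂ (λ u v → DCoset r (τ (syndrome cols u)) v) (sym (take-++ x y)) (sym (drop-++ x y))
      (subst (λ u → DCoset r (τ u) y) (sym syn[x]≡a) (Dₐ⇒DCoset _ y y∈D))

  InS⇒S : ∀ z → InS z → S cols τ z
  InS⇒S z z∈S = syn z , xPart z , yPart z , refl , DCoset⇒Dₐ _ _ z∈S , sym (split z)

  φ : W → W → W
  φ s z = (xPart s ⊕ μ⟨ syn s ⟩ (xPart z)) ++ (yPart s ⊕ ψ⟨ syn s ⟩ (yPart z))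

  xPart-φ : ∀ s z → xPart (φ s z) ≡ xPart s ⊕ μ⟨ syn s ⟩ (xPart z)
  xPart-φ s z = take-++ _ _

  yPart-φ : ∀ s z → yPart (φ s z) ≡ yPart s ⊕ ψ⟨ syn s ⟩ (yPart z)
  yPart-φ s z = drop-++ (xPart s ⊕ μ⟨ syn s ⟩ (xPart z)) _

  syn-φ : ∀ s z → syn (φ s z) ≡ syn s ⋆ syn z
  syn-φ s z = begin
    syndrome cols (xPart (φ s z))
      ≡⟨ cong (syndrome cols) (xPart-φ s z) ⟩
    syndrome cols (xPart s ⊕ μ⟨ syn s ⟩ (xPart z))
      ≡⟨ syndrome-⊕ (xPart s) _ ⟩
    syn s ⊕ syndrome cols (μ⟨ syn s ⟩ (xPart z))
      ≡⟨ cong (syn s ⊕_) (Mon.syndrome-μ (syn s) (xPart z)) ⟩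
    syn s ⊕ (linearPart (syn s) ·ᵥ syn z)
      ≡⟨ ⋆≡⊕ (syn s) (syn z) ⟨
    syn s ⋆ syn z ∎
    where open ≡-Reasoning

  InS-φ : ∀ s z → InS s → InS z → InS (φ s z)
  InS-φ s z s∈S z∈S = subst₂ (DCoset r) τ-syn-φ (sym (yPart-φ s z))
    (DCoset-⊕ s∈S (DCoset-relabel (linearPart (τ (syn s))) (linearPart⁻¹ (τ (syn s)))
                     (linearPart-inverseʳ (τ (syn s))) (linearPart-inverseˡ (τ (syn s))) z∈S))
    where
    τ-syn-φ : τ (syn s) ⊕ (linearPart (τ (syn s)) ·ᵥ τ (syn z)) ≡ τ (syn (φ s z))
    τ-syn-φ = trans (sym (⋆≡⊕ _ _)) (trans (sym (τ-⋆ A {τ} I (syn s) (syn z))) (cong τ (sym (syn-φ s z))))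

  φ-∘ : ∀ s t z → φ s (φ t z) ≡ φ (φ s t) z
  φ-∘ s t z = cong₂ _++_
    (begin
      xPart s ⊕ μ⟨ syn s ⟩ (xPart (φ t z))
        ≡⟨ cong (λ u → xPart s ⊕ μ⟨ syn s ⟩ u) (xPart-φ t z) ⟩
      xPart s ⊕ μ⟨ syn s ⟩ (xPart t ⊕ μ⟨ syn t ⟩ (xPart z))
        ≡⟨ TwistedX.twisted-assoc (syn s) (syn t) (xPart s) (xPart t) (xPart z) ⟩
      (xPart s ⊕ μ⟨ syn s ⟩ (xPart t)) ⊕ μ⟨ syn s ⋆ syn t ⟩ (xPart z)
        ≡⟨ cong₂ (λ u c → u ⊕ μ⟨ c ⟩ (xPart z)) (sym (xPart-φ s t)) (sym (syn-φ s t)) ⟩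
      xPart (φ s t) ⊕ μ⟨ syn (φ s t) ⟩ (xPart z) ∎)
    (begin
      yPart s ⊕ ψ⟨ syn s ⟩ (yPart (φ t z))
        ≡⟨ cong (λ u → yPart s ⊕ ψ⟨ syn s ⟩ u) (yPart-φ t z) ⟩
      yPart s ⊕ ψ⟨ syn s ⟩ (yPart t ⊕ ψ⟨ syn t ⟩ (yPart z))
        ≡⟨ TwistedY.twisted-assoc (syn s) (syn t) (yPart s) (yPart t) (yPart z) ⟩
      (yPart s ⊕ ψ⟨ syn s ⟩ (yPart t)) ⊕ ψ⟨ syn s ⋆ syn t ⟩ (yPart z)
        ≡⟨ cong₂ (λ u c → u ⊕ ψ⟨ c ⟩ (yPart z)) (sym (yPart-φ s t)) (sym (syn-φ s t)) ⟩
      yPart (φ s t) ⊕ ψ⟨ syn (φ s t) ⟩ (yPart z) ∎)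
    where open ≡-Reasoning

  xPart-𝟎 : xPart 𝟎 ≡ 𝟎
  xPart-𝟎 = trans (cong xPart (𝟎-++ n (Q r))) (take-++ 𝟎 𝟎)

  yPart-𝟎 : yPart 𝟎 ≡ 𝟎
  yPart-𝟎 = trans (cong yPart (𝟎-++ n (Q r))) (drop-++ (𝟎 {n}) 𝟎)

  syn-𝟎 : syn 𝟎 ≡ 𝟎
  syn-𝟎 = trans (cong (syndrome cols) xPart-𝟎) syndrome-𝟎

  InS-𝟎 : InS 𝟎
  InS-𝟎 = subst₂ (DCoset r) (sym (trans (cong τ syn-𝟎) (τ-𝟎 A {τ} I))) (sym yPart-𝟎) DCoset-𝟎

  φ-identityˡ : ∀ z → φ 𝟎 z ≡ z
  φ-identityˡ z = trans (cong₂ _++_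
    (trans (cong₂ (λ u c → u ⊕ μ⟨ c ⟩ (xPart z)) xPart-𝟎 syn-𝟎) (TwistedX.twisted-identityˡ (xPart z)))
    (trans (cong₂ (λ u c → u ⊕ ψ⟨ c ⟩ (yPart z)) yPart-𝟎 syn-𝟎) (TwistedY.twisted-identityˡ (yPart z))))
    (split z)

  φ-identityʳ : ∀ s → φ s 𝟎 ≡ s
  φ-identityʳ s = trans (cong₂ _++_
    (trans (cong (λ u → xPart s ⊕ μ⟨ syn s ⟩ u) xPart-𝟎) (TwistedX.twisted-identityʳ (syn s) (xPart s)))
    (trans (cong (λ u → yPart s ⊕ ψ⟨ syn s ⟩ u) yPart-𝟎) (TwistedY.twisted-identityʳ (syn s) (yPart s))))
    (split s)

  _⁻ʷ : W → W
  s ⁻ʷ = (⊖ μ⟨ syn s ⁻ ⟩ (xPart s)) ++ (⊖ ψ⟨ syn s ⁻ ⟩ (yPart s))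

  xPart-⁻ʷ : ∀ s → xPart (s ⁻ʷ) ≡ ⊖ μ⟨ syn s ⁻ ⟩ (xPart s)
  xPart-⁻ʷ s = take-++ _ _

  yPart-⁻ʷ : ∀ s → yPart (s ⁻ʷ) ≡ ⊖ ψ⟨ syn s ⁻ ⟩ (yPart s)
  yPart-⁻ʷ s = drop-++ (⊖ μ⟨ syn s ⁻ ⟩ (xPart s)) _

  syn-⁻ʷ : ∀ s → syn (s ⁻ʷ) ≡ syn s ⁻
  syn-⁻ʷ s = begin
    syndrome cols (xPart (s ⁻ʷ))                          ≡⟨ cong (syndrome cols) (xPart-⁻ʷ s) ⟩
    syndrome cols (⊖ μ⟨ a ⁻ ⟩ (xPart s))                  ≡⟨ syndrome-⊖ (μ⟨ a ⁻ ⟩ (xPart s)) ⟩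
    ⊖ syndrome cols (μ⟨ a ⁻ ⟩ (xPart s))                  ≡⟨ cong ⊖_ (Mon.syndrome-μ (a ⁻) (xPart s)) ⟩
    ⊖ (linearPart (a ⁻) ·ᵥ a)                             ≡⟨ cong ⊖_ (⋆≡𝟎⇒linearPart≡⊖ (a ⁻) a (⋆-inverseˡ a)) ⟩
    ⊖ (⊖ (a ⁻))                                           ≡⟨ ⊖-involutive (a ⁻) ⟩
    a ⁻                                                   ∎
    where
    open ≡-Reasoning
    a : V r
    a = syn s

  InS-⁻ʷ : ∀ s → InS s → InS (s ⁻ʷ)
  InS-⁻ʷ s s∈S = subst₂ (DCoset r) τ-syn-⁻ʷ (sym (yPart-⁻ʷ s))
    (DCoset-⊖ (DCoset-relabel (linearPart b) (linearPart⁻¹ b) (linearPart-inverseʳ b) (linearPart-inverseˡ b) s∈S))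
    where
    a b : V r
    a = syn s
    b = τ (a ⁻)
    τ-syn-⁻ʷ : ⊖ (linearPart b ·ᵥ τ a) ≡ τ (syn (s ⁻ʷ))
    τ-syn-⁻ʷ = begin
      ⊖ (linearPart b ·ᵥ τ a) ≡⟨ cong ⊖_ (⋆≡𝟎⇒linearPart≡⊖ b (τ a) b⋆τa≡𝟎) ⟩
      ⊖ (⊖ b)                 ≡⟨ ⊖-involutive b ⟩
      τ (a ⁻)                 ≡⟨ cong τ (syn-⁻ʷ s) ⟨
      τ (syn (s ⁻ʷ))          ∎
      where
      open ≡-Reasoning
      b⋆τa≡𝟎 : b ⋆ τ a ≡ 𝟎
      b⋆τa≡𝟎 = trans (sym (τ-⋆ A {τ} I (a ⁻) a)) (trans (cong τ (⋆-inverseˡ a)) (τ-𝟎 A {τ} I))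

  φ-inverseʳ : ∀ s → φ s (s ⁻ʷ) ≡ 𝟎
  φ-inverseʳ s = trans (cong₂ _++_
    (trans (cong (λ u → xPart s ⊕ μ⟨ syn s ⟩ u) (xPart-⁻ʷ s)) (TwistedX.twisted-inverseʳ (syn s) (xPart s)))
    (trans (cong (λ u → yPart s ⊕ ψ⟨ syn s ⟩ u) (yPart-⁻ʷ s)) (TwistedY.twisted-inverseʳ (syn s) (yPart s))))
    (sym (𝟎-++ n (Q r)))

  φ-inverseˡ : ∀ s → φ (s ⁻ʷ) s ≡ 𝟎
  φ-inverseˡ s = trans (cong₂ _++_
    (trans (cong₂ (λ u c → u ⊕ μ⟨ c ⟩ (xPart s)) (xPart-⁻ʷ s) (syn-⁻ʷ s)) (⊕-inverseˡ _))
    (trans (cong₂ (λ u c → u ⊕ ψ⟨ c ⟩ (yPart s)) (yPart-⁻ʷ s) (syn-⁻ʷ s)) (⊕-inverseˡ _)))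
    (sym (𝟎-++ n (Q r)))

  φ-φ⁻ʷ : ∀ s z → φ s (φ (s ⁻ʷ) z) ≡ z
  φ-φ⁻ʷ s z = trans (φ-∘ s (s ⁻ʷ) z) (trans (cong (λ u → φ u z) (φ-inverseʳ s)) (φ-identityˡ z))

  φ⁻ʷ-φ : ∀ s z → φ (s ⁻ʷ) (φ s z) ≡ z
  φ⁻ʷ-φ s z = trans (φ-∘ (s ⁻ʷ) s z) (trans (cong (λ u → φ u z) (φ-inverseˡ s)) (φ-identityˡ z))

  φ-free : ∀ s t z → φ s z ≡ φ t z → s ≡ t
  φ-free s t z φsz≡φtz = trans (sym (split s)) (trans (cong₂ _++_ x≡ y≡) (split t))
    where
    syn≡ : syn s ≡ syn t
    syn≡ = ⋆-cancelʳ (syn z) (syn s) (syn t) (trans (sym (syn-φ s z)) (trans (cong syn φsz≡φtz) (syn-φ t z)))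
    x≡ : xPart s ≡ xPart t
    x≡ = ⊕-cancelʳ (μ⟨ syn s ⟩ (xPart z)) (xPart s) (xPart t)
      (trans (sym (xPart-φ s z)) (trans (cong xPart φsz≡φtz)
        (trans (xPart-φ t z) (cong (λ c → xPart t ⊕ μ⟨ c ⟩ (xPart z)) (sym syn≡)))))
    y≡ : yPart s ≡ yPart t
    y≡ = ⊕-cancelʳ (ψ⟨ syn s ⟩ (yPart z)) (yPart s) (yPart t)
      (trans (sym (yPart-φ s z)) (trans (cong yPart φsz≡φtz)
        (trans (yPart-φ t z) (cong (λ c → yPart t ⊕ ψ⟨ c ⟩ (yPart z)) (sym syn≡)))))

  dist-ψ : ∀ a y y′ → dist (ψ⟨ a ⟩ y) (ψ⟨ a ⟩ y′) ≡ dist y y′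
  dist-ψ a = dist-relabel (linearPart b) (linearPart⁻¹ b) (linearPart-inverseʳ b) (linearPart-inverseˡ b)
    where
    b : V r
    b = τ a

  dist-φ : ∀ s z z′ → dist (φ s z) (φ s z′) ≡ dist z z′
  dist-φ s z z′ = begin
    dist (φ s z) (φ s z′)
      ≡⟨ dist-++ (xPart s ⊕ μₐ u) (xPart s ⊕ μₐ u′) (yPart s ⊕ ψₐ v) (yPart s ⊕ ψₐ v′) ⟩
    dist (xPart s ⊕ μₐ u) (xPart s ⊕ μₐ u′) + dist (yPart s ⊕ ψₐ v) (yPart s ⊕ ψₐ v′)
      ≡⟨ cong₂ _+_ (dist-⊕ˡ (xPart s) (μₐ u) (μₐ u′)) (dist-⊕ˡ (yPart s) (ψₐ v) (ψₐ v′)) ⟩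
    dist (μₐ u) (μₐ u′) + dist (ψₐ v) (ψₐ v′)
      ≡⟨ cong₂ _+_ (Mon.dist-μ (syn s) u u′) (dist-ψ (syn s) v v′) ⟩
    dist u u′ + dist v v′
      ≡⟨ dist-++ u u′ v v′ ⟨
    dist (u ++ v) (u′ ++ v′)
      ≡⟨ cong₂ dist (split z) (split z′) ⟩
    dist z z′ ∎
    where
    open ≡-Reasoning
    μₐ : V n → V n
    μₐ = μ⟨ syn s ⟩
    ψₐ : Vec Carrier (Q r) → Vec Carrier (Q r)
    ψₐ = ψ⟨ syn s ⟩
    u u′ : V n
    u = xPart z
    u′ = xPart z′
    v v′ : Vec Carrier (Q r)
    v = yPart z
    v′ = yPart z′

  Φ : (W → W) → Set
  Φ f = ∃[ s ] (S cols τ s × (∀ z → f z ≡ φ s z))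

  S-φ : ∀ s z → S cols τ s → S cols τ z → S cols τ (φ s z)
  S-φ s z s∈S z∈S = InS⇒S (φ s z) (InS-φ s z (S⇒InS s s∈S) (S⇒InS z z∈S))

  S-⁻ʷ : ∀ s → S cols τ s → S cols τ (s ⁻ʷ)
  S-⁻ʷ s s∈S = InS⇒S (s ⁻ʷ) (InS-⁻ʷ s (S⇒InS s s∈S))

  Φ-isRegularStabSubgroup : IsRegularStabSubgroup (S cols τ) Φ
  Φ-isRegularStabSubgroup = record
    { isometry   = λ { f (s , _ , f≗φs) →
                     (λ x y → trans (cong₂ dist (f≗φs x) (f≗φs y)) (dist-φ s x y)) ,
                     φ (s ⁻ʷ) , (λ z → trans (f≗φs _) (φ-φ⁻ʷ s z)) , (λ z → trans (cong (φ (s ⁻ʷ)) (f≗φs z)) (φ⁻ʷ-φ s z)) }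
    ; stab       = λ { f (s , s∈S , f≗φs) x →
                     (λ x∈S → subst (S cols τ) (sym (f≗φs x)) (S-φ s x s∈S x∈S)) ,
                     (λ fx∈S → subst (S cols τ) (φ⁻ʷ-φ s x) (S-φ (s ⁻ʷ) (φ s x) (S-⁻ʷ s s∈S) (subst (S cols τ) (f≗φs x) fx∈S))) }
    ; hasId      = 𝟎 , InS⇒S 𝟎 InS-𝟎 , (λ z → sym (φ-identityˡ z))
    ; closed     = λ { f g (s , s∈S , f≗φs) (t , t∈S , g≗φt) →
                     φ s t , S-φ s t s∈S t∈S , (λ z → trans (f≗φs _) (trans (cong (φ s) (g≗φt z)) (φ-∘ s t z))) }
    ; inv        = λ { f (s , s∈S , f≗φs) →
                     φ (s ⁻ʷ) , (s ⁻ʷ , S-⁻ʷ s s∈S , (λ _ → refl)) ,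
                     (λ z → trans (f≗φs _) (φ-φ⁻ʷ s z)) , (λ z → trans (cong (φ (s ⁻ʷ)) (f≗φs z)) (φ⁻ʷ-φ s z)) }
    ; transitive = λ x y x∈S y∈S →
                     φ (φ y (x ⁻ʷ)) , (φ y (x ⁻ʷ) , S-φ y (x ⁻ʷ) y∈S (S-⁻ʷ x x∈S) , (λ _ → refl)) ,
                     trans (sym (φ-∘ y (x ⁻ʷ) x)) (trans (cong (φ y) (φ-inverseˡ x)) (φ-identityʳ y))
    ; free       = λ { f g x (s , _ , f≗φs) (t , _ , g≗φt) _ fx≡gx z →
                     trans (f≗φs z) (trans (cong (λ u → φ u z) (φ-free s t x (trans (sym (f≗φs x)) (trans fx≡gx (g≗φt x)))))
                                           (sym (g≗φt z))) }
    }

  S-propelinear : Propelinear (S cols τ)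
  S-propelinear = Φ , Φ-isRegularStabSubgroup

proposition2 : (F : FiniteField) → let open Over F in
  (r₁ r₂ : ℕ) → r₁ ≥ 1 → r₂ ≥ 1 →
  (G₁ : Aff r₁ → Set) (G₂ : Aff r₂ → Set) →
  IsRegularSubgroup G₁ → IsRegularSubgroup G₂ →
  (T₁ : Aff r₁ → Aff r₁) (T₂ : Aff r₂ → Aff r₂) →
  IsAutomorphism G₁ T₁ → IsAutomorphism G₂ T₂ →
  (τ₁ : V r₁ → V r₁) (τ₂ : V r₂ → V r₂) →
  Induces G₁ T₁ τ₁ → Induces G₂ T₂ τ₂ →
  IsRegularSubgroup (G₁ ⊗ G₂) ×
  (∃[ T ] (IsAutomorphism (G₁ ⊗ G₂) T × Induces (G₁ ⊗ G₂) T (τ₁ ∣ₚ τ₂))) ×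
  ((n : ℕ) (H : Vec (V (r₁ Data.Nat.+ r₂)) n) → IsSubspaceMatrix H →
    Propelinear (S H (τ₁ ∣ₚ τ₂)))
proposition2 F r₁ r₂ _ _ G₁ G₂ reg₁ reg₂ T₁ T₂ A₁ A₂ τ₁ τ₂ I₁ I₂ =
  reg , (T₁ ⊗ᵀ T₂ , A , I) , λ n H H-subspace → S-propelinear (G₁ ⊗ G₂) reg A I H H-subspace
  where
  open Over F using (_⊗_; IsRegularSubgroup; IsAutomorphism; Induces; _∣ₚ_)
  open Tensor F
  open PropelinearStructure F using (S-propelinear)
  reg : IsRegularSubgroup (G₁ ⊗ G₂)
  reg = ⊗-isRegularSubgroup reg₁ reg₂
  A : IsAutomorphism (G₁ ⊗ G₂) (T₁ ⊗ᵀ T₂)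
  A = ⊗-isAutomorphism A₁ A₂
  I : Induces (G₁ ⊗ G₂) (T₁ ⊗ᵀ T₂) (τ₁ ∣ₚ τ₂)
  I = ⊗-induces τ₁ τ₂ I₁ I₂
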